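{- For all integers $n\ge m\ge 3$, $\mathrm{opt}^{S}_{W}(G_{n,m}) \le \left\lceil \frac{(n-2)(m-2)}{2}\right\rceil + \frac{3(m+n)}{4} + 3$.
   Context: $G_{n,m}$ is the rectangular grid with $n$ rows and $m$ columns, squares $(i,j)$. A wall is a unit segment separating two adjacent squares; the grid boundary also acts as a wall. A robot starts on $(1,1)$. A move: choose one of the four directions; the robot slides and stops on the last square before it would cross a wall or leave the grid. A set of walls is a solution of the wall/stop game if for every square there is a sequence of moves from $(1,1)$ after which the robot stands on it. $\mathrm{opt}^{S}_{W}(G_{n,m})$ is the minimum number of walls in such a solution. -}

module Defs where

open import Data.Nat using (ℕ; zero; suc; _+_; _*_; _∸_; _≤_; _<_; ⌈_/2⌉)
open import Data.Product using (_×_; _,_; ∃)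
open import Data.Sum using (_⊎_)
open import Data.List using (List; length)
open import Data.List.Membership.Propositional using (_∈_; _∉_)
open import Data.List.Relation.Unary.All using (All)
open import Data.List.Relation.Unary.Unique.Propositional using (Unique)
open import Relation.Binary.PropositionalEquality using (_≡_)

-- Squares are (row , column), 0-indexed: row i < n, column j < m.
-- The paper's square (1,1) is (0 , 0) here.
Square : Set
Square = ℕ × ℕ

-- Interior walls (the boundary always acts as a wall and is not counted).
--   H i j : the wall between squares (i , j) and (i , j+1)
--   V i j : the wall between squares (i , j) and (i+1 , j)
data Wall : Set where
  H : ℕ → ℕ → Wall
  V : ℕ → ℕ → Wall

ValidWall : ℕ → ℕ → Wall → Set
ValidWall n m (H i j) = i < n × suc j < m
ValidWall n m (V i j) = suc i < n × j < m

data Dir : Set where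
  left right up down : Dir

Slide : ℕ → ℕ → List Wall → Dir → Square → Square → Set
Slide n m W right (i , j) (i' , j') =
  i' ≡ i × j ≤ j' × j' < m
  × (∀ k → j ≤ k → k < j' → H i k ∉ W)
  × (suc j' ≡ m ⊎ H i j' ∈ W)
Slide n m W left (i , j) (i' , j') =
  i' ≡ i × j' ≤ j
  × (∀ k → j' ≤ k → k < j → H i k ∉ W)
  × (j' ≡ 0 ⊎ ∃ λ k → suc k ≡ j' × H i k ∈ W)
Slide n m W down (i , j) (i' , j') =
  j' ≡ j × i ≤ i' × i' < n
  × (∀ k → i ≤ k → k < i' → V k j ∉ W)
  × (suc i' ≡ n ⊎ V i' j ∈ W)
Slide n m W up (i , j) (i' , j') =
  j' ≡ j × i' ≤ i
  × (∀ k → i' ≤ k → k < i → V k j ∉ W)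
  × (i' ≡ 0 ⊎ ∃ λ k → suc k ≡ i' × V k j ∈ W)

data Reachable (n m : ℕ) (W : List Wall) : Square → Set where
  start : Reachable n m W (0 , 0)
  step  : ∀ {p q} (d : Dir) → Reachable n m W p → Slide n m W d p q →
          Reachable n m W q

-- W (a duplicate-free list of interior walls, i.e. a finite set of walls)
-- is a solution of the wall/stop game on G_{n,m}.
IsSolution : ℕ → ℕ → List Wall → Set
IsSolution n m W =
  Unique W × All (ValidWall n m) W
  × (∀ i j → i < n → j < m → Reachable n m W (i , j))

-- opt^S_W(G_{n,m}) ≤ b  is read as: some solution has at most b walls.
-- opt ≤ ⌈(n-2)(m-2)/2⌉ + 3(m+n)/4 + 3, multiplied through by 4
-- (opt and ⌈..⌉ are integers, so this is equivalent).
OptBound : ℕ → ℕ → Set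
OptBound n m = ∃ λ W → IsSolution n m W
  × 4 * length W ≤ 4 * ⌈ (n ∸ 2) * (m ∸ 2) /2⌉ + 3 * (m + n) + 12

module Submission where

-- The walls are periodic modulo 4: an interior row i carries a horizontal wall
-- after every column j ≡ i, an interior column j a vertical wall below every row
-- i ≡ j + 1 (mod 4); the four border lines get slightly different patterns.
--
-- Rank a square by 4(i + j) + potential(i , j), where the
-- potential is a bounded correction read off a table indexed by the diagonal
-- class of (i , j) mod 4 and the distances (capped at 3) to the four borders.
-- Every square except (0 , 0) is the end point of a slide of length ≤ 3 from a
-- square of smaller rank ("a decreasing move"), so well-founded induction on
-- the rank reaches every square.  Whether a decreasing move exists depends only
-- on the residues mod 4 and on the distances to the borders up to 8 (the
-- relation Agree), so it is enough to verify it on the finitely many grids whose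
-- coordinates and distances are below 12; that is done by evaluation.
--
-- Each row or column pattern selects one residue class mod 4, hence
-- at most (L + 3)/4 of the L wall positions, and four consecutive interior
-- lines together hold exactly L walls; summing gives
-- 4 · |walls| ≤ 2(n-2)(m-2) + 3(m + n) + 12.

open import Defs
open import Data.Nat using (ℕ; zero; suc; _+_; _*_; _∸_; _≤_; _<_; z≤n; s≤s; _≡ᵇ_; _<ᵇ_; _≤ᵇ_; _<?_; ⌈_/2⌉; ⌊_/2⌋)
open import Data.Nat.Properties
open import Data.Nat.Induction using (<-rec)
open import Data.Nat.Tactic.RingSolver using (solve-∀)
open import Data.Bool using (Bool; true; false; _∧_; _∨_; not; if_then_else_; T; T?)
open import Data.Bool.Properties using (T-≡; ∧-conicalˡ; ∧-conicalʳ; ¬-not; not-injective)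
open import Data.Product using (_×_; _,_; ∃; proj₁; proj₂; Σ)
open import Data.Sum using (_⊎_; inj₁; inj₂)
open import Data.Empty using (⊥-elim)
open import Data.List using (List; []; _∷_; _++_; map; length; filterᵇ; downFrom; upTo)
open import Data.Bool.ListAction using (any; all; or)
open import Data.List.Properties using (length-map; length-++; map-cong-local)
open import Data.List.Membership.Propositional using (_∈_; _∉_)
open import Data.List.Membership.Propositional.Properties
  using (∈-++⁺ˡ; ∈-++⁺ʳ; ∈-++⁻; ∈-map⁺; ∈-map⁻; ∈-filter⁺; ∈-filter⁻; ∈-downFrom⁺; ∈-downFrom⁻; ∈-upTo⁺)
open import Data.List.Relation.Unary.All using (All; []; _∷_)
open import Data.List.Relation.Unary.All.Properties using (all⁺)
open import Data.List.Relation.Unary.Any using (satisfied)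
open import Data.List.Relation.Unary.Any.Properties using (any⁻)
open import Data.Unit using (tt)
import Data.List.Relation.Unary.All as All
open import Data.List.Relation.Unary.AllPairs using ([])
open import Data.List.Relation.Unary.Unique.Propositional using (Unique)
import Data.List.Relation.Unary.Unique.Propositional.Properties as Unique
open import Function using (_∘_; Equivalence)
open import Relation.Binary.PropositionalEquality using (_≡_; refl; sym; trans; cong; cong₂; subst; _≢_; module ≡-Reasoning)
open import Relation.Nullary using (¬_; yes; no)

∨-true : ∀ a b → a ∨ b ≡ true → a ≡ true ⊎ b ≡ true
∨-true true  _ _ = inj₁ refl
∨-true false _ e = inj₂ e

∨-false-left : ∀ {a b} → a ≡ false → a ∨ b ≡ true → b ≡ true
∨-false-left refl e = e

-- Facts are kept as boolean equations b ≡ true; the following transport the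
-- library's T-based reflection lemmas to that form.
¬true⇒false : ∀ {b} → b ≢ true → b ≡ false
¬true⇒false = ¬-not

≡true⇒T : ∀ {b} → b ≡ true → T b
≡true⇒T = Equivalence.from T-≡

T⇒≡true : ∀ {b} → T b → b ≡ true
T⇒≡true = Equivalence.to T-≡

<ᵇ⇒<′ : ∀ {a b} → (a <ᵇ b) ≡ true → a < b
<ᵇ⇒<′ {a} {b} = <ᵇ⇒< a b ∘ ≡true⇒T

<⇒<ᵇ′ : ∀ {a b} → a < b → (a <ᵇ b) ≡ true
<⇒<ᵇ′ = T⇒≡true ∘ <⇒<ᵇ

≮⇒<ᵇ-false : ∀ {a b} → ¬ (a < b) → (a <ᵇ b) ≡ false
≮⇒<ᵇ-false a≮b = ¬true⇒false (a≮b ∘ <ᵇ⇒<′)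

≤ᵇ⇒≤′ : ∀ {a b} → (a ≤ᵇ b) ≡ true → a ≤ b
≤ᵇ⇒≤′ {a} {b} = ≤ᵇ⇒≤ a b ∘ ≡true⇒T

≤⇒≤ᵇ′ : ∀ {a b} → a ≤ b → (a ≤ᵇ b) ≡ true
≤⇒≤ᵇ′ = T⇒≡true ∘ ≤⇒≤ᵇ

≡ᵇ⇒≡′ : ∀ {a b} → (a ≡ᵇ b) ≡ true → a ≡ b
≡ᵇ⇒≡′ {a} {b} = ≡ᵇ⇒≡ a b ∘ ≡true⇒T

≢⇒≡ᵇ-false : ∀ {a b} → a ≢ b → (a ≡ᵇ b) ≡ false
≢⇒≡ᵇ-false a≢b = ¬true⇒false (a≢b ∘ ≡ᵇ⇒≡′)

allBelow : ℕ → (ℕ → Bool) → Bool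
allBelow B p = all p (upTo B)

allBelow-sound : ∀ B p → T (allBelow B p) → ∀ x → x < B → p x ≡ true
allBelow-sound B p h x x<B = T⇒≡true (All.lookup (all⁺ p (upTo B) h) (∈-upTo⁺ x<B))

allBelow²-sound : ∀ B (p : ℕ → ℕ → Bool) → T (allBelow B λ x → allBelow B (p x)) →
                  ∀ x y → x < B → y < B → p x y ≡ true
allBelow²-sound B p h x y x<B y<B =
  allBelow-sound B (p x) (≡true⇒T (allBelow-sound B (λ x → allBelow B (p x)) h x x<B)) y y<B

∧-cong-lazy : ∀ {a a' b b'} → a ≡ a' → (a ≡ true → b ≡ b') → a ∧ b ≡ a' ∧ b'
∧-cong-lazy {true}  refl f = f refl
∧-cong-lazy {false} refl f = refl

mod4 : ℕ → ℕ
mod4 0 = 0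
mod4 1 = 1
mod4 2 = 2
mod4 3 = 3
mod4 (suc (suc (suc (suc x)))) = mod4 x

next4 : ℕ → ℕ
next4 0 = 1
next4 1 = 2
next4 2 = 3
next4 _ = 0

mod4<4 : ∀ x → mod4 x < 4
mod4<4 0 = s≤s z≤n
mod4<4 1 = s≤s (s≤s z≤n)
mod4<4 2 = s≤s (s≤s (s≤s z≤n))
mod4<4 3 = s≤s (s≤s (s≤s (s≤s z≤n)))
mod4<4 (suc (suc (suc (suc x)))) = mod4<4 x

mod4-idem : ∀ x → mod4 (mod4 x) ≡ mod4 x
mod4-idem 0 = refl
mod4-idem 1 = refl
mod4-idem 2 = refl
mod4-idem 3 = refl
mod4-idem (suc (suc (suc (suc x)))) = mod4-idem x

mod4-suc : ∀ a → mod4 (suc a) ≡ next4 (mod4 a)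
mod4-suc 0 = refl
mod4-suc 1 = refl
mod4-suc 2 = refl
mod4-suc 3 = refl
mod4-suc (suc (suc (suc (suc a)))) = mod4-suc a

mod4-2+ : ∀ a → mod4 (2 + a) ≡ next4 (next4 (mod4 a))
mod4-2+ a = trans (mod4-suc (suc a)) (cong next4 (mod4-suc a))

mod4-3+ : ∀ a → mod4 (3 + a) ≡ next4 (next4 (next4 (mod4 a)))
mod4-3+ a = trans (mod4-suc (2 + a)) (cong next4 (mod4-2+ a))

mod4-suc-cong : ∀ a b → mod4 a ≡ mod4 b → mod4 (suc a) ≡ mod4 (suc b)
mod4-suc-cong a b e = trans (mod4-suc a) (trans (cong next4 e) (sym (mod4-suc b)))

-- Since 4 + a reduces to a, three more steps undo a step.
mod4-suc-cancel : ∀ a b → mod4 (suc a) ≡ mod4 (suc b) → mod4 a ≡ mod4 b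
mod4-suc-cancel a b e = begin
  mod4 a                                ≡⟨ mod4-3+ (suc a) ⟩
  next4 (next4 (next4 (mod4 (suc a))))  ≡⟨ cong (λ r → next4 (next4 (next4 r))) e ⟩
  next4 (next4 (next4 (mod4 (suc b))))  ≡⟨ sym (mod4-3+ (suc b)) ⟩
  mod4 b                                ∎
  where open ≡-Reasoning

mod4-+ˡ : ∀ a a' b → mod4 a ≡ mod4 a' → mod4 (a + b) ≡ mod4 (a' + b)
mod4-+ˡ a a' zero e = trans (cong mod4 (+-identityʳ a)) (trans e (cong mod4 (sym (+-identityʳ a'))))
mod4-+ˡ a a' (suc b) e =
  trans (cong mod4 (+-suc a b))
    (trans (mod4-suc-cong (a + b) (a' + b) (mod4-+ˡ a a' b e)) (cong mod4 (sym (+-suc a' b))))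

mod4-+ʳ : ∀ b a a' → mod4 a ≡ mod4 a' → mod4 (b + a) ≡ mod4 (b + a')
mod4-+ʳ b a a' e = trans (cong mod4 (+-comm b a)) (trans (mod4-+ˡ a a' b e) (cong mod4 (+-comm a' b)))

hPattern : ℕ → ℕ → ℕ → ℕ → Bool
hPattern n m i j =
  if i ≡ᵇ 0 then mod4 j ≡ᵇ 3
  else if (n ∸ suc i) ≡ᵇ 0
    then (if (m ≡ᵇ 4) ∧ (mod4 n ≡ᵇ 2) then j ≡ᵇ 1 else mod4 j ≡ᵇ mod4 n)
  else mod4 j ≡ᵇ mod4 i

vPattern : ℕ → ℕ → ℕ → ℕ → Bool
vPattern n m i j =
  if j ≡ᵇ 0 then (i ≡ᵇ 1) ∨ ((mod4 i ≡ᵇ 0) ∧ not (i ≡ᵇ 0))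
  else if (m ∸ suc j) ≡ᵇ 0 then mod4 i ≡ᵇ mod4 (suc m)
  else mod4 j ≡ᵇ mod4 (3 + i)

hasH : ℕ → ℕ → ℕ → ℕ → Bool
hasH n m i j = (i <ᵇ n) ∧ ((suc j <ᵇ m) ∧ hPattern n m i j)

hasV : ℕ → ℕ → ℕ → ℕ → Bool
hasV n m i j = (suc i <ᵇ n) ∧ ((j <ᵇ m) ∧ vPattern n m i j)

hasH-valid : ∀ {n m i j} → hasH n m i j ≡ true → i < n × suc j < m × hPattern n m i j ≡ true
hasH-valid {n} {m} {i} {j} e =
  let i<n = ∧-conicalˡ (i <ᵇ n) _ e ; rest = ∧-conicalʳ (i <ᵇ n) _ e in
  <ᵇ⇒<′ i<n , <ᵇ⇒<′ (∧-conicalˡ (suc j <ᵇ m) _ rest) , ∧-conicalʳ (suc j <ᵇ m) _ rest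

hasV-valid : ∀ {n m i j} → hasV n m i j ≡ true → suc i < n × j < m × vPattern n m i j ≡ true
hasV-valid {n} {m} {i} {j} e =
  let i<n = ∧-conicalˡ (suc i <ᵇ n) _ e ; rest = ∧-conicalʳ (suc i <ᵇ n) _ e in
  <ᵇ⇒<′ i<n , <ᵇ⇒<′ (∧-conicalˡ (j <ᵇ m) _ rest) , ∧-conicalʳ (j <ᵇ m) _ rest

select : (ℕ → Bool) → ℕ → List ℕ
select p k = filterᵇ p (downFrom k)

select⁻ : ∀ p k {x} → x ∈ select p k → x < k × p x ≡ true
select⁻ p k mem with ∈-filter⁻ (T? ∘ p) mem
... | x∈ , px = ∈-downFrom⁻ x∈ , T⇒≡true px

select⁺ : ∀ p k {x} → x < k → p x ≡ true → x ∈ select p k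
select⁺ p k x<k px = ∈-filter⁺ (T? ∘ p) (∈-downFrom⁺ x<k) (≡true⇒T px)

select-unique : ∀ p k → Unique (select p k)
select-unique p k = Unique.filter⁺ (T? ∘ p) (Unique.downFrom⁺ k)

suc<⇒<∸1 : ∀ {a b} → suc a < b → a < b ∸ 1
suc<⇒<∸1 {a} {suc b} (s≤s p) = p

<∸1⇒suc< : ∀ {a b} → a < b ∸ 1 → suc a < b
<∸1⇒suc< {a} {suc b} p = s≤s p

H-injective : ∀ {i a b} → H i a ≡ H i b → a ≡ b
H-injective refl = refl

V-injective : ∀ {j a b} → V a j ≡ V b j → a ≡ b
V-injective refl = refl

module WallSet (n m : ℕ) where

  hRow : ℕ → List Wall
  hRow i = map (H i) (select (hPattern n m i) (m ∸ 1))

  hWalls : ℕ → List Wall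
  hWalls zero    = []
  hWalls (suc i) = hRow i ++ hWalls i

  vCol : ℕ → List Wall
  vCol j = map (λ x → V x j) (select (λ x → vPattern n m x j) (n ∸ 1))

  vWalls : ℕ → List Wall
  vWalls zero    = []
  vWalls (suc j) = vCol j ++ vWalls j

  walls : List Wall
  walls = hWalls n ++ vWalls m

  hWalls⁻ : ∀ k {i j} → H i j ∈ hWalls k → i < k × j < m ∸ 1 × hPattern n m i j ≡ true
  hWalls⁻ (suc k) mem with ∈-++⁻ (hRow k) mem
  ... | inj₂ mem' = let (i<k , rest) = hWalls⁻ k mem' in m<n⇒m<1+n i<k , rest
  ... | inj₁ mem' with ∈-map⁻ (H k) mem'
  ...   | x , x∈ , refl = ≤-refl , select⁻ (hPattern n m k) (m ∸ 1) x∈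

  hWalls-noV : ∀ k {i j} → V i j ∉ hWalls k
  hWalls-noV (suc k) mem with ∈-++⁻ (hRow k) mem
  ... | inj₂ mem' = hWalls-noV k mem'
  ... | inj₁ mem' with ∈-map⁻ (H k) mem'
  ...   | _ , _ , ()

  hWalls⁺ : ∀ k {i j} → i < k → j < m ∸ 1 → hPattern n m i j ≡ true → H i j ∈ hWalls k
  hWalls⁺ (suc k) {i} {j} i<k j<m p with m<1+n⇒m<n∨m≡n i<k
  ... | inj₂ refl = ∈-++⁺ˡ (∈-map⁺ (H i) (select⁺ (hPattern n m i) (m ∸ 1) j<m p))
  ... | inj₁ i<k' = ∈-++⁺ʳ (hRow k) (hWalls⁺ k i<k' j<m p)

  vWalls⁻ : ∀ k {i j} → V i j ∈ vWalls k → j < k × i < n ∸ 1 × vPattern n m i j ≡ true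
  vWalls⁻ (suc k) mem with ∈-++⁻ (vCol k) mem
  ... | inj₂ mem' = let (j<k , rest) = vWalls⁻ k mem' in m<n⇒m<1+n j<k , rest
  ... | inj₁ mem' with ∈-map⁻ (λ x → V x k) mem'
  ...   | x , x∈ , refl = ≤-refl , select⁻ (λ x → vPattern n m x k) (n ∸ 1) x∈

  vWalls-noH : ∀ k {i j} → H i j ∉ vWalls k
  vWalls-noH (suc k) mem with ∈-++⁻ (vCol k) mem
  ... | inj₂ mem' = vWalls-noH k mem'
  ... | inj₁ mem' with ∈-map⁻ (λ x → V x k) mem'
  ...   | _ , _ , ()

  vWalls⁺ : ∀ k {i j} → j < k → i < n ∸ 1 → vPattern n m i j ≡ true → V i j ∈ vWalls k
  vWalls⁺ (suc k) {i} {j} j<k i<n p with m<1+n⇒m<n∨m≡n j<k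
  ... | inj₂ refl = ∈-++⁺ˡ (∈-map⁺ (λ x → V x j) (select⁺ (λ x → vPattern n m x j) (n ∸ 1) i<n p))
  ... | inj₁ j<k' = ∈-++⁺ʳ (vCol k) (vWalls⁺ k j<k' i<n p)

  hWalls-unique : ∀ k → Unique (hWalls k)
  hWalls-unique zero    = []
  hWalls-unique (suc k) =
    Unique.++⁺ (Unique.map⁺ H-injective (select-unique (hPattern n m k) (m ∸ 1))) (hWalls-unique k) disjoint
    where
    disjoint : ∀ {w} → ¬ (w ∈ hRow k × w ∈ hWalls k)
    disjoint {H _ _} (inRow , inRest) with ∈-map⁻ (H k) inRow
    ... | _ , _ , refl = <-irrefl refl (proj₁ (hWalls⁻ k inRest))
    disjoint {V _ _} (_ , inRest) = hWalls-noV k inRest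

  vWalls-unique : ∀ k → Unique (vWalls k)
  vWalls-unique zero    = []
  vWalls-unique (suc k) =
    Unique.++⁺ (Unique.map⁺ V-injective (select-unique (λ x → vPattern n m x k) (n ∸ 1))) (vWalls-unique k) disjoint
    where
    disjoint : ∀ {w} → ¬ (w ∈ vCol k × w ∈ vWalls k)
    disjoint {V _ _} (inCol , inRest) with ∈-map⁻ (λ x → V x k) inCol
    ... | _ , _ , refl = <-irrefl refl (proj₁ (vWalls⁻ k inRest))
    disjoint {H _ _} (_ , inRest) = vWalls-noH k inRest

  walls-unique : Unique walls
  walls-unique = Unique.++⁺ (hWalls-unique n) (vWalls-unique m) disjoint
    where
    disjoint : ∀ {w} → ¬ (w ∈ hWalls n × w ∈ vWalls m)
    disjoint {H _ _} (_ , inV) = vWalls-noH m inV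
    disjoint {V _ _} (inH , _) = hWalls-noV n inH

  hasH⇒∈ : ∀ {i j} → hasH n m i j ≡ true → H i j ∈ walls
  hasH⇒∈ e = let (i<n , j<m , p) = hasH-valid {n} {m} e in ∈-++⁺ˡ (hWalls⁺ n i<n (suc<⇒<∸1 j<m) p)

  ∈⇒hasH : ∀ {i j} → H i j ∈ walls → hasH n m i j ≡ true
  ∈⇒hasH {i} {j} mem with ∈-++⁻ (hWalls n) mem
  ... | inj₂ inV = ⊥-elim (vWalls-noH m inV)
  ... | inj₁ inH with hWalls⁻ n inH
  ...   | i<n , j<m , p rewrite <⇒<ᵇ′ i<n | <⇒<ᵇ′ (<∸1⇒suc< {j} {m} j<m) | p = refl

  hasH-false⇒∉ : ∀ {i j} → hasH n m i j ≡ false → H i j ∉ walls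
  hasH-false⇒∉ e mem with trans (sym (∈⇒hasH mem)) e
  ... | ()

  hasV⇒∈ : ∀ {i j} → hasV n m i j ≡ true → V i j ∈ walls
  hasV⇒∈ e = let (i<n , j<m , p) = hasV-valid {n} {m} e in ∈-++⁺ʳ (hWalls n) (vWalls⁺ m j<m (suc<⇒<∸1 i<n) p)

  ∈⇒hasV : ∀ {i j} → V i j ∈ walls → hasV n m i j ≡ true
  ∈⇒hasV {i} {j} mem with ∈-++⁻ (hWalls n) mem
  ... | inj₁ inH = ⊥-elim (hWalls-noV n inH)
  ... | inj₂ inV with vWalls⁻ m inV
  ...   | j<m , i<n , p rewrite <⇒<ᵇ′ j<m | <⇒<ᵇ′ (<∸1⇒suc< {i} {n} i<n) | p = refl

  hasV-false⇒∉ : ∀ {i j} → hasV n m i j ≡ false → V i j ∉ walls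
  hasV-false⇒∉ e mem with trans (sym (∈⇒hasV mem)) e
  ... | ()

  walls-valid : All (ValidWall n m) walls
  walls-valid = All.tabulate valid
    where
    valid : ∀ {w} → w ∈ walls → ValidWall n m w
    valid {H i j} mem = let (i<n , j<m , _) = hasH-valid {n} {m} (∈⇒hasH mem) in i<n , j<m
    valid {V i j} mem = let (i<n , j<m , _) = hasV-valid {n} {m} (∈⇒hasV mem) in i<n , j<m

slidesRight : ℕ → ℕ → ℕ → ℕ → ℕ → Bool
slidesRight n m i y zero    = (suc y ≡ᵇ m) ∨ hasH n m i y
slidesRight n m i y (suc k) = not (hasH n m i y) ∧ slidesRight n m i (suc y) k

clearH : ℕ → ℕ → ℕ → ℕ → ℕ → Bool
clearH n m i y zero    = true
clearH n m i y (suc k) = not (hasH n m i y) ∧ clearH n m i (suc y) k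

blockedLeft : ℕ → ℕ → ℕ → ℕ → Bool
blockedLeft n m i zero    = true
blockedLeft n m i (suc y) = hasH n m i y

slidesDown : ℕ → ℕ → ℕ → ℕ → ℕ → Bool
slidesDown n m x j zero    = (suc x ≡ᵇ n) ∨ hasV n m x j
slidesDown n m x j (suc k) = not (hasV n m x j) ∧ slidesDown n m (suc x) j k

clearV : ℕ → ℕ → ℕ → ℕ → ℕ → Bool
clearV n m x j zero    = true
clearV n m x j (suc k) = not (hasV n m x j) ∧ clearV n m (suc x) j k

blockedUp : ℕ → ℕ → ℕ → ℕ → Bool
blockedUp n m zero    j = true
blockedUp n m (suc x) j = hasV n m x j

module SlideSoundness (n m : ℕ) where
  open WallSet n m

  clearH-sound : ∀ k i y → clearH n m i y k ≡ true → ∀ z → y ≤ z → z < y + k → H i z ∉ walls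
  clearH-sound zero i y e z y≤z z<y = ⊥-elim (<-irrefl refl (≤-trans (subst (z <_) (+-identityʳ y) z<y) y≤z))
  clearH-sound (suc k) i y e z y≤z z<y with m≤n⇒m<n∨m≡n y≤z
  ... | inj₂ refl = hasH-false⇒∉ (not-injective (∧-conicalˡ _ _ e))
  ... | inj₁ y<z  = clearH-sound k i (suc y) (∧-conicalʳ _ _ e) z y<z (subst (z <_) (+-suc y k) z<y)

  clearV-sound : ∀ k x j → clearV n m x j k ≡ true → ∀ z → x ≤ z → z < x + k → V z j ∉ walls
  clearV-sound zero x j e z x≤z z<x = ⊥-elim (<-irrefl refl (≤-trans (subst (z <_) (+-identityʳ x) z<x) x≤z))
  clearV-sound (suc k) x j e z x≤z z<x with m≤n⇒m<n∨m≡n x≤z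
  ... | inj₂ refl = hasV-false⇒∉ (not-injective (∧-conicalˡ _ _ e))
  ... | inj₁ x<z  = clearV-sound k (suc x) j (∧-conicalʳ _ _ e) z x<z (subst (z <_) (+-suc x k) z<x)

  slideRight-sound : ∀ k i y → slidesRight n m i y k ≡ true → y + k < m →
                     Slide n m walls right (i , y) (i , y + k)
  slideRight-sound zero i y e lt rewrite +-identityʳ y =
    refl , ≤-refl , lt , (λ z y≤z z<y → ⊥-elim (<-irrefl refl (≤-trans z<y y≤z))) , stop (∨-true _ _ e)
    where
    stop : (suc y ≡ᵇ m) ≡ true ⊎ hasH n m i y ≡ true → suc y ≡ m ⊎ H i y ∈ walls
    stop (inj₁ atBorder) = inj₁ (≡ᵇ⇒≡′ atBorder)
    stop (inj₂ wall)     = inj₂ (hasH⇒∈ wall)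
  slideRight-sound (suc k) i y e lt rewrite +-suc y k
    with slideRight-sound k i (suc y) (∧-conicalʳ _ _ e) lt
  ... | _ , y<y' , lt' , free , stop = refl , ≤-trans (n≤1+n y) y<y' , lt' , free' , stop
    where
    free' : ∀ z → y ≤ z → z < suc (y + k) → H i z ∉ walls
    free' z y≤z z<y' with m≤n⇒m<n∨m≡n y≤z
    ... | inj₁ y<z  = free z y<z z<y'
    ... | inj₂ refl = hasH-false⇒∉ (not-injective (∧-conicalˡ _ _ e))

  slideDown-sound : ∀ k x j → slidesDown n m x j k ≡ true → x + k < n →
                    Slide n m walls down (x , j) (x + k , j)
  slideDown-sound zero x j e lt rewrite +-identityʳ x =
    refl , ≤-refl , lt , (λ z x≤z z<x → ⊥-elim (<-irrefl refl (≤-trans z<x x≤z))) , stop (∨-true _ _ e)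
    where
    stop : (suc x ≡ᵇ n) ≡ true ⊎ hasV n m x j ≡ true → suc x ≡ n ⊎ V x j ∈ walls
    stop (inj₁ atBorder) = inj₁ (≡ᵇ⇒≡′ atBorder)
    stop (inj₂ wall)     = inj₂ (hasV⇒∈ wall)
  slideDown-sound (suc k) x j e lt rewrite +-suc x k
    with slideDown-sound k (suc x) j (∧-conicalʳ _ _ e) lt
  ... | _ , x<x' , lt' , free , stop = refl , ≤-trans (n≤1+n x) x<x' , lt' , free' , stop
    where
    free' : ∀ z → x ≤ z → z < suc (x + k) → V z j ∉ walls
    free' z x≤z z<x' with m≤n⇒m<n∨m≡n x≤z
    ... | inj₁ x<z  = free z x<z z<x'
    ... | inj₂ refl = hasV-false⇒∉ (not-injective (∧-conicalˡ _ _ e))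

  slideLeft-sound : ∀ k i y → (blockedLeft n m i y ∧ clearH n m i y k) ≡ true →
                    Slide n m walls left (i , y + k) (i , y)
  slideLeft-sound k i y e =
    refl , m≤m+n y k , clearH-sound k i y (∧-conicalʳ _ _ e) , stop y (∧-conicalˡ _ _ e)
    where
    stop : ∀ y → blockedLeft n m i y ≡ true → y ≡ 0 ⊎ ∃ λ z → suc z ≡ y × H i z ∈ walls
    stop zero    _    = inj₁ refl
    stop (suc y) wall = inj₂ (y , refl , hasH⇒∈ wall)

  slideUp-sound : ∀ k x j → (blockedUp n m x j ∧ clearV n m x j k) ≡ true →
                  Slide n m walls up (x + k , j) (x , j)
  slideUp-sound k x j e =
    refl , m≤m+n x k , clearV-sound k x j (∧-conicalʳ _ _ e) , stop x (∧-conicalˡ _ _ e)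
    where
    stop : ∀ x → blockedUp n m x j ≡ true → x ≡ 0 ⊎ ∃ λ z → suc z ≡ x × V z j ∈ walls
    stop zero    _    = inj₁ refl
    stop (suc x) wall = inj₂ (x , refl , hasV⇒∈ wall)

-- Agree t n x n' x': the position x on a line of n squares and the position x'
-- on a line of n' squares are indistinguishable at scale t: their distances to
-- the start, and d , d' to the end, are equal or both at least t, and positions
-- and lengths are congruent mod 4.  Everything the wall pattern and the
-- potential see at a square is determined by such data (with t = 8).
record Agree (t n x n' x' : ℕ) : Set where
  field
    d d'       : ℕ
    length≡    : n ≡ suc (x + d)
    length′≡   : n' ≡ suc (x' + d')
    near-start : x < t → x ≡ x'
    far-start  : t ≤ x → t ≤ x'
    near-end   : d < t → d ≡ d'
    far-end    : t ≤ d → t ≤ d'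
    pos-mod4   : mod4 x ≡ mod4 x'
    len-mod4   : mod4 n ≡ mod4 n'

open Agree

cutoff-weaken : ∀ {t s a b} → t ≤ s → (a < s → a ≡ b) → (s ≤ a → s ≤ b) → t ≤ a → t ≤ b
cutoff-weaken {t} {s} {a} t≤s near far t≤a with a <? s
... | yes a<s = subst (t ≤_) (near a<s) t≤a
... | no  a≮s = ≤-trans t≤s (far (≮⇒≥ a≮s))

Agree-weaken : ∀ {t s n x n' x'} → t ≤ s → Agree s n x n' x' → Agree t n x n' x'
Agree-weaken t≤s A = record
  { d = d A ; d' = d' A ; length≡ = length≡ A ; length′≡ = length′≡ A
  ; near-start = λ p → near-start A (<-≤-trans p t≤s)
  ; far-start  = cutoff-weaken t≤s (near-start A) (far-start A)
  ; near-end   = λ p → near-end A (<-≤-trans p t≤s)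
  ; far-end    = cutoff-weaken t≤s (near-end A) (far-end A)
  ; pos-mod4 = pos-mod4 A ; len-mod4 = len-mod4 A }

ConstantFrom : {A : Set} → ℕ → (ℕ → A) → Set
ConstantFrom c f = ∀ y → c ≤ y → f y ≡ f c

agree-start : ∀ {A : Set} (f : ℕ → A) c {t n x n' x'} → ConstantFrom c f → c ≤ t →
              Agree t n x n' x' → f x ≡ f x'
agree-start f c {t} {x = x} {x' = x'} const c≤t A with x <? t
... | yes x<t = cong f (near-start A x<t)
... | no  x≮t = trans (const x (≤-trans c≤t (≮⇒≥ x≮t)))
                      (sym (const x' (≤-trans c≤t (far-start A (≮⇒≥ x≮t)))))

agree-end : ∀ {A : Set} (f : ℕ → A) c {t n x n' x'} → ConstantFrom c f → c ≤ t →
            (A : Agree t n x n' x') → f (d A) ≡ f (d' A)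
agree-end f c {t} const c≤t A with d A <? t
... | yes d<t = cong f (near-end A d<t)
... | no  d≮t = trans (const (d A) (≤-trans c≤t (≮⇒≥ d≮t)))
                      (sym (const (d' A) (≤-trans c≤t (far-end A (≮⇒≥ d≮t)))))

Agree-suc : ∀ {t n x n' x'} → Agree (suc t) n x n' x' → suc x < n → Agree t n (suc x) n' (suc x')
Agree-suc {t} {n} {x} {n'} {x'} A sx<n = shift (d A) (d' A) (length≡ A) (length′≡ A) (near-end A) (far-end A)
  where
  shift : ∀ e e' → n ≡ suc (x + e) → n' ≡ suc (x' + e') →
         (e < suc t → e ≡ e') → (suc t ≤ e → suc t ≤ e') → Agree t n (suc x) n' (suc x')
  shift zero e' len _ _ = ⊥-elim (<-irrefl refl (<-≤-trans sx<n (≤-reflexive (trans len (cong suc (+-identityʳ x))))))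
  shift (suc e) zero _ _ near far with e <? t
  ... | yes e<t with near (s≤s e<t)
  ...   | ()
  shift (suc e) zero _ _ near far | no e≮t with far (s≤s (≮⇒≥ e≮t))
  ... | ()
  shift (suc e) (suc e') len len' near far = record
    { d = e ; d' = e'
    ; length≡ = trans len (cong suc (+-suc x e)) ; length′≡ = trans len' (cong suc (+-suc x' e'))
    ; near-start = λ p → cong suc (near-start A (≤-trans (n≤1+n (suc x)) (≤-trans p (n≤1+n t))))
    ; far-start  = far-start′
    ; near-end   = λ p → suc-injective (near (s≤s p))
    ; far-end    = λ p → ≤-pred (far (s≤s p))
    ; pos-mod4 = mod4-suc-cong x x' (pos-mod4 A) ; len-mod4 = len-mod4 A }
    where
    far-start′ : t ≤ suc x → t ≤ suc x'
    far-start′ p with x <? suc t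
    ... | yes x<t = subst (λ z → t ≤ suc z) (near-start A x<t) p
    ... | no  x≮t = ≤-trans (n≤1+n t) (≤-trans (far-start A (≮⇒≥ x≮t)) (n≤1+n x'))

Agree-pred : ∀ {t n x n' x'} → Agree (suc t) n (suc x) n' x' → Σ ℕ λ x₀ → x' ≡ suc x₀ × Agree t n x n' x₀
Agree-pred {t} {x = x} {x' = zero} A with suc x <? suc t
... | yes x<t with near-start A x<t
...   | ()
Agree-pred {t} {x = x} {x' = zero} A | no x≮t with far-start A (≮⇒≥ x≮t)
... | ()
Agree-pred {t} {x = x} {x' = suc x₀} A = x₀ , refl , record
  { d = suc (d A) ; d' = suc (d' A)
  ; length≡  = trans (length≡ A) (cong suc (sym (+-suc x (d A))))
  ; length′≡ = trans (length′≡ A) (cong suc (sym (+-suc x₀ (d' A))))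
  ; near-start = λ p → suc-injective (near-start A (s≤s p))
  ; far-start  = λ p → ≤-pred (far-start A (s≤s p))
  ; near-end   = λ p → cong suc (near-end A (m<n⇒m<1+n (≤-trans (n≤1+n (suc (d A))) p)))
  ; far-end    = far-end′
  ; pos-mod4 = mod4-suc-cancel x x₀ (pos-mod4 A) ; len-mod4 = len-mod4 A }
  where
  far-end′ : t ≤ suc (d A) → t ≤ suc (d' A)
  far-end′ p with d A <? suc t
  ... | yes d<t = subst (λ z → t ≤ suc z) (near-end A d<t) p
  ... | no  d≮t = ≤-trans (n≤1+n t) (≤-trans (far-end A (≮⇒≥ d≮t)) (n≤1+n (d' A)))

Agree-∸ : ∀ k {t n x n' x'} → Agree (t + k) n x n' x' → k ≤ x → Agree t n (x ∸ k) n' (x' ∸ k)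
Agree-∸ zero {t} A _ = subst (λ s → Agree s _ _ _ _) (+-identityʳ t) A
Agree-∸ (suc k) {t} {n} {suc x} {n'} {x'} A (s≤s k≤x)
  with Agree-pred (subst (λ s → Agree s n (suc x) n' x') (+-suc t k) A)
... | _ , refl , A' = Agree-∸ k A' k≤x

Agree-+ : ∀ k {t n x n' x'} → Agree (t + k) n x n' x' → x + k < n → Agree t n (x + k) n' (x' + k)
Agree-+ zero {t} {n} {x} {n'} {x'} A _
  rewrite +-identityʳ t | +-identityʳ x | +-identityʳ x' = A
Agree-+ (suc k) {t} {n} {x} {n'} {x'} A lt
  rewrite +-suc x k | +-suc x' k =
  Agree-+ k (Agree-suc (subst (λ s → Agree s n x n' x') (+-suc t k) A) (≤-<-trans (s≤s (m≤m+n x k)) lt)) lt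

longer-than : ∀ {t a s l} → a ≤ s → l ≡ suc s → t ≤ a → t < l
longer-than a≤s refl t≤a = s≤s (≤-trans t≤a a≤s)

Agree-length : ∀ {t n x n' x'} → Agree t n x n' x' → n ≡ n' ⊎ (t < n × t < n')
Agree-length {t} {n} {x} {n'} {x'} A with x <? t | d A <? t
... | yes x<t | yes d<t =
  inj₁ (trans (length≡ A) (trans (cong₂ (λ a b → suc (a + b)) (near-start A x<t) (near-end A d<t)) (sym (length′≡ A))))
... | no x≮t | _ =
  inj₂ (longer-than (m≤m+n x (d A)) (length≡ A) (≮⇒≥ x≮t) ,
        longer-than (m≤m+n x' (d' A)) (length′≡ A) (far-start A (≮⇒≥ x≮t)))
... | yes _ | no d≮t =
  inj₂ (longer-than (m≤n+m (d A) x) (length≡ A) (≮⇒≥ d≮t) ,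
        longer-than (m≤n+m (d' A) x') (length′≡ A) (far-end A (≮⇒≥ d≮t)))

>⇒≡ᵇ-false : ∀ {c n} → c < n → (n ≡ᵇ c) ≡ false
>⇒≡ᵇ-false {c} {n} c<n = ≢⇒≡ᵇ-false {n} {c} (λ { refl → <-irrefl refl c<n })

agree-length-test : ∀ c {t n x n' x'} → c < t → Agree t n x n' x' → (n ≡ᵇ c) ≡ (n' ≡ᵇ c)
agree-length-test c c<t A with Agree-length A
... | inj₁ n≡n' = cong (_≡ᵇ c) n≡n'
... | inj₂ (t<n , t<n') = trans (>⇒≡ᵇ-false (<-trans c<t t<n)) (sym (>⇒≡ᵇ-false (<-trans c<t t<n')))

≡ᵇ0-const : ConstantFrom 1 (_≡ᵇ 0)
≡ᵇ0-const (suc y) _ = refl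

≡ᵇ1-const : ConstantFrom 2 (_≡ᵇ 1)
≡ᵇ1-const (suc (suc y)) _       = refl
≡ᵇ1-const (suc zero)    (s≤s ())

0<ᵇ-const : ConstantFrom 1 (0 <ᵇ_)
0<ᵇ-const (suc y) _ = refl

≤ᵇ-const : ∀ k → ConstantFrom k (k ≤ᵇ_)
≤ᵇ-const k y k≤y = trans (≤⇒≤ᵇ′ k≤y) (sym (≤⇒≤ᵇ′ (≤-refl {k})))

x<ᵇ1+x+d : ∀ x d → (x <ᵇ suc (x + d)) ≡ true
x<ᵇ1+x+d x d = <⇒<ᵇ′ (s≤s (m≤m+n x d))

y<ᵇy+e : ∀ y e → (y <ᵇ y + e) ≡ (0 <ᵇ e)
y<ᵇy+e zero    e = refl
y<ᵇy+e (suc y) e = y<ᵇy+e y e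

y≡ᵇy+e : ∀ y e → (y ≡ᵇ y + e) ≡ (e ≡ᵇ 0)
y≡ᵇy+e zero zero    = refl
y≡ᵇy+e zero (suc e) = refl
y≡ᵇy+e (suc y) e    = y≡ᵇy+e y e

1+j+k≤ᵇ1+j+d : ∀ j k d → (suc (j + k) ≤ᵇ suc (j + d)) ≡ (k ≤ᵇ d)
1+j+k≤ᵇ1+j+d zero zero    d = refl
1+j+k≤ᵇ1+j+d zero (suc k) d = refl
1+j+k≤ᵇ1+j+d (suc j) k d    = 1+j+k≤ᵇ1+j+d j k d

hShape : (x≡0 last m≡4 : Bool) (n%4 : ℕ) (y≡1 : Bool) (y%4 x%4 : ℕ) → Bool
hShape x≡0 last m≡4 n%4 y≡1 y%4 x%4 =
  if x≡0 then y%4 ≡ᵇ 3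
  else if last then (if m≡4 ∧ (n%4 ≡ᵇ 2) then y≡1 else y%4 ≡ᵇ n%4)
  else y%4 ≡ᵇ x%4

vShape : (y≡0 last x≡1 : Bool) (x%4 : ℕ) (x≡0 : Bool) (m+2%4 y%4 x+3%4 : ℕ) → Bool
vShape y≡0 last x≡1 x%4 x≡0 m+2%4 y%4 x+3%4 =
  if y≡0 then x≡1 ∨ ((x%4 ≡ᵇ 0) ∧ not x≡0)
  else if last then x%4 ≡ᵇ m+2%4
  else y%4 ≡ᵇ x+3%4

hasH-features : ∀ x d y e → hasH (suc (x + d)) (suc (y + e)) x y ≡
  (0 <ᵇ e) ∧ hShape (x ≡ᵇ 0) (d ≡ᵇ 0) (suc (y + e) ≡ᵇ 4) (mod4 (suc (x + d))) (y ≡ᵇ 1) (mod4 y) (mod4 x)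
hasH-features x d y e rewrite x<ᵇ1+x+d x d | y<ᵇy+e y e | m+n∸m≡n x d = refl

hasV-features : ∀ x d y e → hasV (suc (x + d)) (suc (y + e)) x y ≡
  (0 <ᵇ d) ∧ vShape (y ≡ᵇ 0) (e ≡ᵇ 0) (x ≡ᵇ 1) (mod4 x) (x ≡ᵇ 0) (mod4 (suc (suc (y + e)))) (mod4 y) (mod4 (3 + x))
hasV-features x d y e rewrite x<ᵇ1+x+d y e | y<ᵇy+e x d | m+n∸m≡n y e = refl

length-mod4 : ∀ {t n x n' x'} (A : Agree t n x n' x') → mod4 (suc (x + d A)) ≡ mod4 (suc (x' + d' A))
length-mod4 A = trans (cong mod4 (sym (length≡ A))) (trans (len-mod4 A) (cong mod4 (length′≡ A)))

module _ {t s n x n' x' m y m' y'} (AX : Agree t n x n' x') (AY : Agree s m y m' y') where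

  via-features : ∀ (f : ℕ → ℕ → ℕ → ℕ → Bool) (F : ℕ → ℕ → ℕ → ℕ → Bool) →
    (∀ x d y e → f (suc (x + d)) (suc (y + e)) x y ≡ F x d y e) →
    F x (d AX) y (d AY) ≡ F x' (d' AX) y' (d' AY) → f n m x y ≡ f n' m' x' y'
  via-features f F nf eq = begin
    f n m x y                                  ≡⟨ cong₂ (λ a b → f a b x y) (length≡ AX) (length≡ AY) ⟩
    f (suc (x + d AX)) (suc (y + d AY)) x y    ≡⟨ nf x (d AX) y (d AY) ⟩
    F x (d AX) y (d AY)                        ≡⟨ eq ⟩
    F x' (d' AX) y' (d' AY)                    ≡⟨ sym (nf x' (d' AX) y' (d' AY)) ⟩
    f (suc (x' + d' AX)) (suc (y' + d' AY)) x' y' ≡⟨ sym (cong₂ (λ a b → f a b x' y') (length′≡ AX) (length′≡ AY)) ⟩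
    f n' m' x' y'                              ∎
    where open ≡-Reasoning

  hasH-agree : 2 ≤ t → 2 ≤ s → (m ≡ᵇ 4) ≡ (m' ≡ᵇ 4) → hasH n m x y ≡ hasH n' m' x' y'
  hasH-agree 2≤t 2≤s m≡4 = via-features hasH _ hasH-features
    (cong₂ _∧_ (agree-end (0 <ᵇ_) 1 0<ᵇ-const 1≤s AY) shape)
    where
    1≤t = ≤-trans (s≤s z≤n) 2≤t
    1≤s = ≤-trans (s≤s z≤n) 2≤s
    m≡4′ : (suc (y + d AY) ≡ᵇ 4) ≡ (suc (y' + d' AY) ≡ᵇ 4)
    m≡4′ = trans (cong (_≡ᵇ 4) (sym (length≡ AY))) (trans m≡4 (cong (_≡ᵇ 4) (length′≡ AY)))
    shape : hShape (x ≡ᵇ 0) (d AX ≡ᵇ 0) (suc (y + d AY) ≡ᵇ 4) (mod4 (suc (x + d AX))) (y ≡ᵇ 1) (mod4 y) (mod4 x)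
          ≡ hShape (x' ≡ᵇ 0) (d' AX ≡ᵇ 0) (suc (y' + d' AY) ≡ᵇ 4) (mod4 (suc (x' + d' AX))) (y' ≡ᵇ 1) (mod4 y') (mod4 x')
    shape rewrite agree-start (_≡ᵇ 0) 1 ≡ᵇ0-const 1≤t AX | agree-end (_≡ᵇ 0) 1 ≡ᵇ0-const 1≤t AX
                | m≡4′ | length-mod4 AX | agree-start (_≡ᵇ 1) 2 ≡ᵇ1-const 2≤s AY
                | pos-mod4 AY | pos-mod4 AX = refl

  hasV-agree : 2 ≤ t → 2 ≤ s → hasV n m x y ≡ hasV n' m' x' y'
  hasV-agree 2≤t 2≤s = via-features hasV _ hasV-features
    (cong₂ _∧_ (agree-end (0 <ᵇ_) 1 0<ᵇ-const 1≤t AX) shape)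
    where
    1≤t = ≤-trans (s≤s z≤n) 2≤t
    1≤s = ≤-trans (s≤s z≤n) 2≤s
    shape : vShape (y ≡ᵇ 0) (d AY ≡ᵇ 0) (x ≡ᵇ 1) (mod4 x) (x ≡ᵇ 0) (mod4 (suc (suc (y + d AY)))) (mod4 y) (mod4 (3 + x))
          ≡ vShape (y' ≡ᵇ 0) (d' AY ≡ᵇ 0) (x' ≡ᵇ 1) (mod4 x') (x' ≡ᵇ 0) (mod4 (suc (suc (y' + d' AY)))) (mod4 y') (mod4 (3 + x'))
    shape rewrite agree-start (_≡ᵇ 0) 1 ≡ᵇ0-const 1≤s AY | agree-end (_≡ᵇ 0) 1 ≡ᵇ0-const 1≤s AY
                | agree-start (_≡ᵇ 1) 2 ≡ᵇ1-const 2≤t AX | agree-start (_≡ᵇ 0) 1 ≡ᵇ0-const 1≤t AX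
                | mod4-suc-cong (suc (y + d AY)) (suc (y' + d' AY)) (length-mod4 AY) | mod4-+ʳ 3 x x' (pos-mod4 AX)
                | pos-mod4 AX | pos-mod4 AY = refl

cap3 : ℕ → ℕ
cap3 0 = 0
cap3 1 = 1
cap3 2 = 2
cap3 _ = 3

cap3-const : ConstantFrom 3 cap3
cap3-const (suc (suc (suc y))) _                   = refl
cap3-const (suc (suc zero))    (s≤s (s≤s ()))
cap3-const (suc zero)          (s≤s ())

diagonalClass : ℕ → ℕ → ℕ
diagonalClass i j = mod4 (mod4 j + (4 ∸ mod4 i))

-- Its values matter only through the finite
-- verification below.
potentialTable : ℕ → ℕ → ℕ → ℕ → ℕ → ℕ
potentialTable 0 0 2 3 0 = 7
potentialTable 0 0 2 3 1 = 10
potentialTable 0 0 2 3 2 = 10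
potentialTable 0 0 2 3 3 = 10
potentialTable 0 0 3 3 0 = 11
potentialTable 0 0 3 3 1 = 12
potentialTable 0 0 3 3 2 = 12
potentialTable 0 0 3 3 3 = 12
potentialTable 0 1 3 3 0 = 2
potentialTable 0 1 3 3 1 = 2
potentialTable 0 1 3 3 2 = 2
potentialTable 0 1 3 3 3 = 2
potentialTable 0 2 0 2 1 = 2
potentialTable 0 2 0 2 2 = 7
potentialTable 0 2 0 2 3 = 7
potentialTable 0 2 0 3 1 = 2
potentialTable 0 2 0 3 2 = 7
potentialTable 0 2 0 3 3 = 7
potentialTable 0 3 0 0 3 = 6
potentialTable 0 3 0 1 1 = 2
potentialTable 0 3 0 1 2 = 12
potentialTable 0 3 0 1 3 = 6
potentialTable 0 3 0 2 1 = 2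
potentialTable 0 3 0 2 2 = 7
potentialTable 0 3 0 2 3 = 6
potentialTable 0 3 0 3 1 = 2
potentialTable 0 3 0 3 2 = 7
potentialTable 0 3 0 3 3 = 6
potentialTable 0 3 1 0 3 = 6
potentialTable 0 3 1 1 1 = 7
potentialTable 0 3 1 1 2 = 13
potentialTable 0 3 1 1 3 = 13
potentialTable 0 3 1 2 1 = 5
potentialTable 0 3 2 0 3 = 6
potentialTable 0 3 2 1 1 = 7
potentialTable 0 3 2 1 2 = 15
potentialTable 0 3 2 1 3 = 15
potentialTable 0 3 2 2 1 = 5
potentialTable 0 3 3 0 3 = 6
potentialTable 0 3 3 1 1 = 7
potentialTable 0 3 3 1 2 = 15
potentialTable 0 3 3 1 3 = 15
potentialTable 0 3 3 2 1 = 5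
potentialTable 1 0 2 1 1 = 5
potentialTable 1 0 2 1 2 = 5
potentialTable 1 0 2 1 3 = 5
potentialTable 1 0 2 3 0 = 5
potentialTable 1 0 2 3 1 = 5
potentialTable 1 0 2 3 2 = 5
potentialTable 1 0 2 3 3 = 5
potentialTable 1 0 3 1 1 = 5
potentialTable 1 0 3 1 2 = 5
potentialTable 1 0 3 1 3 = 5
potentialTable 1 0 3 3 0 = 7
potentialTable 1 0 3 3 1 = 7
potentialTable 1 0 3 3 2 = 7
potentialTable 1 0 3 3 3 = 7
potentialTable 1 1 1 2 0 = 5
potentialTable 1 1 1 2 1 = 5
potentialTable 1 1 1 2 2 = 10
potentialTable 1 1 1 2 3 = 10
potentialTable 1 1 1 3 0 = 5
potentialTable 1 1 1 3 1 = 5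
potentialTable 1 1 1 3 2 = 10
potentialTable 1 1 1 3 3 = 10
potentialTable 1 1 2 2 0 = 5
potentialTable 1 1 2 2 1 = 5
potentialTable 1 1 3 2 0 = 5
potentialTable 1 1 3 2 1 = 5
potentialTable 1 1 3 2 2 = 14
potentialTable 1 1 3 2 3 = 14
potentialTable 1 1 3 3 0 = 5
potentialTable 1 1 3 3 1 = 5
potentialTable 1 1 3 3 2 = 14
potentialTable 1 1 3 3 3 = 14
potentialTable 1 2 1 3 0 = 5
potentialTable 1 2 2 3 0 = 5
potentialTable 1 2 2 3 1 = 8
potentialTable 1 2 2 3 2 = 15
potentialTable 1 2 2 3 3 = 9
potentialTable 1 2 3 3 0 = 5
potentialTable 1 2 3 3 1 = 8
potentialTable 1 2 3 3 2 = 14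
potentialTable 1 2 3 3 3 = 9
potentialTable 1 3 0 0 2 = 2
potentialTable 1 3 0 0 3 = 10
potentialTable 1 3 0 1 2 = 3
potentialTable 1 3 0 1 3 = 3
potentialTable 1 3 0 2 1 = 5
potentialTable 1 3 0 2 2 = 3
potentialTable 1 3 0 2 3 = 3
potentialTable 1 3 1 0 2 = 10
potentialTable 1 3 1 0 3 = 9
potentialTable 1 3 1 1 1 = 5
potentialTable 1 3 1 1 2 = 15
potentialTable 1 3 1 1 3 = 9
potentialTable 1 3 1 2 0 = 5
potentialTable 1 3 1 2 1 = 5
potentialTable 1 3 1 2 2 = 10
potentialTable 1 3 1 2 3 = 9
potentialTable 1 3 1 3 0 = 5
potentialTable 1 3 1 3 1 = 5
potentialTable 1 3 1 3 2 = 10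
potentialTable 1 3 1 3 3 = 9
potentialTable 1 3 2 0 2 = 15
potentialTable 1 3 2 0 3 = 9
potentialTable 1 3 2 1 1 = 5
potentialTable 1 3 2 1 2 = 15
potentialTable 1 3 2 1 3 = 9
potentialTable 1 3 2 2 0 = 5
potentialTable 1 3 2 2 1 = 5
potentialTable 1 3 2 2 2 = 15
potentialTable 1 3 2 2 3 = 9
potentialTable 1 3 2 3 0 = 5
potentialTable 1 3 2 3 1 = 5
potentialTable 1 3 2 3 2 = 15
potentialTable 1 3 2 3 3 = 9
potentialTable 1 3 3 0 2 = 15
potentialTable 1 3 3 0 3 = 9
potentialTable 1 3 3 1 1 = 5
potentialTable 1 3 3 1 2 = 15
potentialTable 1 3 3 1 3 = 9
potentialTable 1 3 3 2 0 = 5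
potentialTable 1 3 3 2 1 = 5
potentialTable 1 3 3 2 2 = 14
potentialTable 1 3 3 2 3 = 9
potentialTable 1 3 3 3 0 = 5
potentialTable 1 3 3 3 1 = 5
potentialTable 1 3 3 3 2 = 14
potentialTable 1 3 3 3 3 = 9
potentialTable 2 0 2 2 1 = 10
potentialTable 2 0 2 2 2 = 15
potentialTable 2 0 2 2 3 = 15
potentialTable 2 0 2 3 0 = 2
potentialTable 2 0 2 3 1 = 10
potentialTable 2 0 2 3 2 = 15
potentialTable 2 0 2 3 3 = 15
potentialTable 2 0 3 2 1 = 9
potentialTable 2 0 3 2 2 = 9
potentialTable 2 0 3 2 3 = 9
potentialTable 2 0 3 3 0 = 4
potentialTable 2 0 3 3 1 = 9
potentialTable 2 0 3 3 2 = 9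
potentialTable 2 0 3 3 3 = 9
potentialTable 2 1 1 3 1 = 5
potentialTable 2 1 1 3 2 = 5
potentialTable 2 1 1 3 3 = 5
potentialTable 2 1 3 3 1 = 9
potentialTable 2 1 3 3 2 = 9
potentialTable 2 1 3 3 3 = 9
potentialTable 2 2 0 0 2 = 5
potentialTable 2 2 0 0 3 = 5
potentialTable 2 2 0 3 1 = 5
potentialTable 2 2 0 3 2 = 5
potentialTable 2 2 0 3 3 = 5
potentialTable 2 2 1 0 2 = 5
potentialTable 2 2 1 0 3 = 5
potentialTable 2 2 2 0 2 = 5
potentialTable 2 2 2 0 3 = 5
potentialTable 2 2 2 3 0 = 3
potentialTable 2 2 2 3 1 = 10
potentialTable 2 2 2 3 2 = 15
potentialTable 2 2 2 3 3 = 14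
potentialTable 2 2 3 0 2 = 5
potentialTable 2 2 3 0 3 = 5
potentialTable 2 2 3 3 0 = 3
potentialTable 2 2 3 3 1 = 9
potentialTable 2 2 3 3 2 = 9
potentialTable 2 2 3 3 3 = 9
potentialTable 2 3 0 0 2 = 5
potentialTable 2 3 0 0 3 = 11
potentialTable 2 3 0 1 1 = 5
potentialTable 2 3 0 1 2 = 5
potentialTable 2 3 0 1 3 = 5
potentialTable 2 3 0 2 1 = 5
potentialTable 2 3 0 2 2 = 5
potentialTable 2 3 0 2 3 = 5
potentialTable 2 3 0 3 1 = 5
potentialTable 2 3 0 3 2 = 5
potentialTable 2 3 0 3 3 = 5
potentialTable 2 3 1 0 2 = 5
potentialTable 2 3 1 0 3 = 13
potentialTable 2 3 1 1 1 = 5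
potentialTable 2 3 1 1 2 = 8
potentialTable 2 3 1 1 3 = 8
potentialTable 2 3 1 2 1 = 10
potentialTable 2 3 1 2 2 = 8
potentialTable 2 3 1 2 3 = 8
potentialTable 2 3 1 3 1 = 5
potentialTable 2 3 1 3 2 = 5
potentialTable 2 3 1 3 3 = 5
potentialTable 2 3 2 0 2 = 5
potentialTable 2 3 2 0 3 = 13
potentialTable 2 3 2 1 1 = 10
potentialTable 2 3 2 1 2 = 20
potentialTable 2 3 2 1 3 = 14
potentialTable 2 3 2 2 1 = 10
potentialTable 2 3 2 2 2 = 15
potentialTable 2 3 2 2 3 = 14
potentialTable 2 3 2 3 1 = 10
potentialTable 2 3 2 3 2 = 15
potentialTable 2 3 2 3 3 = 14
potentialTable 2 3 3 0 2 = 5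
potentialTable 2 3 3 0 3 = 13
potentialTable 2 3 3 1 1 = 10
potentialTable 2 3 3 1 2 = 20
potentialTable 2 3 3 1 3 = 14
potentialTable 2 3 3 2 1 = 10
potentialTable 2 3 3 2 2 = 9
potentialTable 2 3 3 2 3 = 9
potentialTable 2 3 3 3 1 = 9
potentialTable 2 3 3 3 2 = 9
potentialTable 2 3 3 3 3 = 9
potentialTable 3 1 1 3 0 = 2
potentialTable 3 1 1 3 1 = 7
potentialTable 3 1 1 3 2 = 7
potentialTable 3 1 1 3 3 = 7
potentialTable 3 1 3 3 0 = 6
potentialTable 3 1 3 3 1 = 9
potentialTable 3 1 3 3 2 = 9
potentialTable 3 1 3 3 3 = 9
potentialTable 3 2 2 3 0 = 7
potentialTable 3 2 3 3 0 = 6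
potentialTable 3 3 0 0 2 = 7
potentialTable 3 3 0 0 3 = 17
potentialTable 3 3 0 1 2 = 8
potentialTable 3 3 0 1 3 = 2
potentialTable 3 3 1 0 2 = 10
potentialTable 3 3 1 0 3 = 16
potentialTable 3 3 1 1 2 = 8
potentialTable 3 3 1 1 3 = 2
potentialTable 3 3 1 2 0 = 2
potentialTable 3 3 1 3 0 = 7
potentialTable 3 3 2 0 2 = 10
potentialTable 3 3 2 0 3 = 18
potentialTable 3 3 2 1 2 = 8
potentialTable 3 3 2 1 3 = 2
potentialTable 3 3 2 2 0 = 7
potentialTable 3 3 2 3 0 = 7
potentialTable 3 3 3 0 2 = 10
potentialTable 3 3 3 0 3 = 18
potentialTable 3 3 3 1 2 = 8
potentialTable 3 3 3 1 3 = 2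
potentialTable 3 3 3 2 0 = 7
potentialTable 3 3 3 3 0 = 7
potentialTable _ _ _ _ _ = 0

potential : ℕ → ℕ → ℕ → ℕ → ℕ
potential n m i j = potentialTable (diagonalClass i j) (cap3 i) (cap3 (n ∸ suc i)) (cap3 j) (cap3 (m ∸ suc j))

potential-agree : ∀ {t s n x n' x' m y m' y'} → Agree t n x n' x' → Agree s m y m' y' → 3 ≤ t → 3 ≤ s →
                  potential n m x y ≡ potential n' m' x' y'
potential-agree {x = x} {x' = x'} {y = y} {y' = y'} AX AY 3≤t 3≤s
  rewrite length≡ AX | length≡ AY | length′≡ AX | length′≡ AY
        | m+n∸m≡n x (d AX) | m+n∸m≡n y (d AY) | m+n∸m≡n x' (d' AX) | m+n∸m≡n y' (d' AY)
        | pos-mod4 AX | pos-mod4 AY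
        | agree-start cap3 3 cap3-const 3≤t AX | agree-start cap3 3 cap3-const 3≤s AY
        | agree-end cap3 3 cap3-const 3≤t AX | agree-end cap3 3 cap3-const 3≤s AY = refl

run-fits : ∀ {y k m} → y + suc k < m → suc y < m × suc y + k < m
run-fits {y} {k} {m} lt = let lt' = subst (_< m) (+-suc y k) lt in ≤-<-trans (s≤s (m≤m+n y k)) lt' , lt'

2≤2+ : ∀ k → 2 ≤ 2 + k
2≤2+ k = s≤s (s≤s z≤n)

module _ {t n x n' x'} (AX : Agree t n x n' x') (2≤t : 2 ≤ t) where

  slidesRight-agree : ∀ k {m y m' y'} → Agree (2 + k) m y m' y' → y + k < m → (m ≡ᵇ 4) ≡ (m' ≡ᵇ 4) →
                      slidesRight n m x y k ≡ slidesRight n' m' x' y' k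
  slidesRight-agree zero {m} {y} {m'} {y'} AY _ m≡4 =
    cong₂ _∨_ atBorder (hasH-agree AX AY 2≤t (2≤2+ 0) m≡4)
    where
    atBorder : (suc y ≡ᵇ m) ≡ (suc y' ≡ᵇ m')
    atBorder rewrite length≡ AY | length′≡ AY | y≡ᵇy+e y (d AY) | y≡ᵇy+e y' (d' AY) =
      agree-end (_≡ᵇ 0) 1 ≡ᵇ0-const (s≤s z≤n) AY
  slidesRight-agree (suc k) AY lt m≡4 =
    cong₂ _∧_ (cong not (hasH-agree AX AY 2≤t (2≤2+ (suc k)) m≡4))
      (slidesRight-agree k (Agree-suc AY (proj₁ (run-fits lt))) (proj₂ (run-fits lt)) m≡4)

  clearH-agree : ∀ k {m y m' y'} → Agree (2 + k) m y m' y' → y + k < m → (m ≡ᵇ 4) ≡ (m' ≡ᵇ 4) →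
                 clearH n m x y k ≡ clearH n' m' x' y' k
  clearH-agree zero    AY lt m≡4 = refl
  clearH-agree (suc k) AY lt m≡4 =
    cong₂ _∧_ (cong not (hasH-agree AX AY 2≤t (2≤2+ (suc k)) m≡4))
      (clearH-agree k (Agree-suc AY (proj₁ (run-fits lt))) (proj₂ (run-fits lt)) m≡4)

  blockedLeft-agree : ∀ {m y m' y'} → Agree 3 m y m' y' → (m ≡ᵇ 4) ≡ (m' ≡ᵇ 4) →
                      blockedLeft n m x y ≡ blockedLeft n' m' x' y'
  blockedLeft-agree {y = zero} AY _ with near-start AY (s≤s z≤n)
  ... | refl = refl
  blockedLeft-agree {y = suc y} AY m≡4 with Agree-pred AY
  ... | _ , refl , AY' = hasH-agree AX AY' 2≤t ≤-refl m≡4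

module _ {s m y m' y'} (AY : Agree s m y m' y') (2≤s : 2 ≤ s) where

  slidesDown-agree : ∀ k {n x n' x'} → Agree (2 + k) n x n' x' → x + k < n →
                     slidesDown n m x y k ≡ slidesDown n' m' x' y' k
  slidesDown-agree zero {n} {x} {n'} {x'} AX _ =
    cong₂ _∨_ atBorder (hasV-agree AX AY (2≤2+ 0) 2≤s)
    where
    atBorder : (suc x ≡ᵇ n) ≡ (suc x' ≡ᵇ n')
    atBorder rewrite length≡ AX | length′≡ AX | y≡ᵇy+e x (d AX) | y≡ᵇy+e x' (d' AX) =
      agree-end (_≡ᵇ 0) 1 ≡ᵇ0-const (s≤s z≤n) AX
  slidesDown-agree (suc k) AX lt =
    cong₂ _∧_ (cong not (hasV-agree AX AY (2≤2+ (suc k)) 2≤s))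
      (slidesDown-agree k (Agree-suc AX (proj₁ (run-fits lt))) (proj₂ (run-fits lt)))

  clearV-agree : ∀ k {n x n' x'} → Agree (2 + k) n x n' x' → x + k < n →
                 clearV n m x y k ≡ clearV n' m' x' y' k
  clearV-agree zero    AX lt = refl
  clearV-agree (suc k) AX lt =
    cong₂ _∧_ (cong not (hasV-agree AX AY (2≤2+ (suc k)) 2≤s))
      (clearV-agree k (Agree-suc AX (proj₁ (run-fits lt))) (proj₂ (run-fits lt)))

  blockedUp-agree : ∀ {n x n' x'} → Agree 3 n x n' x' → blockedUp n m x y ≡ blockedUp n' m' x' y'
  blockedUp-agree {x = zero} AX with near-start AX (s≤s z≤n)
  ... | refl = refl
  blockedUp-agree {x = suc x} AX with Agree-pred AX
  ... | _ , refl , AX' = hasV-agree AX' AY ≤-refl 2≤s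

-- decreasingMove n m i j dir k: the robot reaches (i , j) by a slide of
-- length k in direction dir from a square of smaller rank, where the rank of
-- (i , j) is 4 (i + j) + potential n m i j.
decreasingMove : ℕ → ℕ → ℕ → ℕ → Dir → ℕ → Bool
decreasingMove n m i j right k =
  (k ≤ᵇ j) ∧ (slidesRight n m i (j ∸ k) k ∧ (potential n m i (j ∸ k) <ᵇ 4 * k + potential n m i j))
decreasingMove n m i j left k =
  (suc (j + k) ≤ᵇ m) ∧ ((blockedLeft n m i j ∧ clearH n m i j k) ∧ (4 * k + potential n m i (j + k) <ᵇ potential n m i j))
decreasingMove n m i j down k =
  (k ≤ᵇ i) ∧ (slidesDown n m (i ∸ k) j k ∧ (potential n m (i ∸ k) j <ᵇ 4 * k + potential n m i j))
decreasingMove n m i j up k =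
  (suc (i + k) ≤ᵇ n) ∧ ((blockedUp n m i j ∧ clearV n m i j k) ∧ (4 * k + potential n m (i + k) j <ᵇ potential n m i j))

Move : Set
Move = Dir × ℕ

moves : List Move
moves = (right , 1) ∷ (down , 1) ∷ (left , 1) ∷ (up , 1) ∷ (left , 2) ∷ (up , 2) ∷ (right , 2) ∷ (down , 2) ∷
        (left , 3) ∷ (up , 3) ∷ (right , 3) ∷ (down , 3) ∷ []

moves-short : All (λ mv → proj₂ mv ≤ 3) moves
moves-short = 1≤3 ∷ 1≤3 ∷ 1≤3 ∷ 1≤3 ∷ 2≤3 ∷ 2≤3 ∷ 2≤3 ∷ 2≤3 ∷ ≤-refl ∷ ≤-refl ∷ ≤-refl ∷ ≤-refl ∷ []
  where
  1≤3 = s≤s z≤n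
  2≤3 = s≤s (s≤s z≤n)

hasDecreasingMove : ℕ → ℕ → ℕ → ℕ → Bool
hasDecreasingMove n m i j = any (λ mv → decreasingMove n m i j (proj₁ mv) (proj₂ mv)) moves

agree-fits-before : ∀ {t n x n' x'} k → k ≤ t → Agree t n x n' x' → (k ≤ᵇ x) ≡ (k ≤ᵇ x')
agree-fits-before k k≤t = agree-start (k ≤ᵇ_) k (≤ᵇ-const k) k≤t

agree-fits-after : ∀ {t n x n' x'} k → k ≤ t → (A : Agree t n x n' x') → (suc (x + k) ≤ᵇ n) ≡ (suc (x' + k) ≤ᵇ n')
agree-fits-after {x = x} {x' = x'} k k≤t A
  rewrite length≡ A | length′≡ A | 1+j+k≤ᵇ1+j+d x k (d A) | 1+j+k≤ᵇ1+j+d x' k (d' A) =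
  agree-end (k ≤ᵇ_) k (≤ᵇ-const k) k≤t A

Agree-pos< : ∀ {t n x n' x'} → Agree t n x n' x' → x < n
Agree-pos< {x = x} A = subst (x <_) (sym (length≡ A)) (s≤s (m≤m+n x (d A)))

module _ {n i n' i' m j m' j'} (AX : Agree 8 n i n' i') (AY : Agree 8 m j m' j') where

  private
    2≤8 : 2 ≤ 8
    2≤8 = m≤m+n 2 6
    3≤8 : 3 ≤ 8
    3≤8 = m≤m+n 3 5
    3≤5 : 3 ≤ 5
    3≤5 = m≤m+n 3 2
    m≡4 : (m ≡ᵇ 4) ≡ (m' ≡ᵇ 4)
    m≡4 = agree-length-test 4 (m≤m+n 5 3) AY
    potential≡ : potential n m i j ≡ potential n' m' i' j'
    potential≡ = potential-agree AX AY 3≤8 3≤8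

  decreasingMove-agree : ∀ dir k → k ≤ 3 → decreasingMove n m i j dir k ≡ decreasingMove n' m' i' j' dir k
  decreasingMove-agree right k k≤3 = ∧-cong-lazy (agree-fits-before k (≤-trans k≤3 3≤8) AY) λ e →
    let k≤j = ≤ᵇ⇒≤′ e
        AY′ = Agree-∸ k (Agree-weaken (+-monoʳ-≤ 5 k≤3) AY) k≤j
    in cong₂ _∧_
         (slidesRight-agree AX 2≤8 k (Agree-weaken (s≤s (s≤s k≤3)) AY′)
           (subst (_< m) (sym (m∸n+n≡m k≤j)) (Agree-pos< AY)) m≡4)
         (cong₂ _<ᵇ_ (potential-agree AX AY′ 3≤8 3≤5) (cong (4 * k +_) potential≡))
  decreasingMove-agree left k k≤3 = ∧-cong-lazy (agree-fits-after k (≤-trans k≤3 3≤8) AY) λ e →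
    let j+k<m = ≤ᵇ⇒≤′ e
        AY′ = Agree-+ k (Agree-weaken (+-monoʳ-≤ 5 k≤3) AY) j+k<m
    in cong₂ _∧_
         (cong₂ _∧_ (blockedLeft-agree AX 2≤8 (Agree-weaken 3≤8 AY) m≡4)
                    (clearH-agree AX 2≤8 k (Agree-weaken (+-monoʳ-≤ 2 (≤-trans k≤3 (m≤m+n 3 3))) AY) j+k<m m≡4))
         (cong₂ _<ᵇ_ (cong (4 * k +_) (potential-agree AX AY′ 3≤8 3≤5)) potential≡)
  decreasingMove-agree down k k≤3 = ∧-cong-lazy (agree-fits-before k (≤-trans k≤3 3≤8) AX) λ e →
    let k≤i = ≤ᵇ⇒≤′ e
        AX′ = Agree-∸ k (Agree-weaken (+-monoʳ-≤ 5 k≤3) AX) k≤i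
    in cong₂ _∧_
         (slidesDown-agree AY 2≤8 k (Agree-weaken (s≤s (s≤s k≤3)) AX′)
           (subst (_< n) (sym (m∸n+n≡m k≤i)) (Agree-pos< AX)))
         (cong₂ _<ᵇ_ (potential-agree AX′ AY 3≤5 3≤8) (cong (4 * k +_) potential≡))
  decreasingMove-agree up k k≤3 = ∧-cong-lazy (agree-fits-after k (≤-trans k≤3 3≤8) AX) λ e →
    let i+k<n = ≤ᵇ⇒≤′ e
        AX′ = Agree-+ k (Agree-weaken (+-monoʳ-≤ 5 k≤3) AX) i+k<n
    in cong₂ _∧_
         (cong₂ _∧_ (blockedUp-agree AY 2≤8 (Agree-weaken 3≤8 AX))
                    (clearV-agree AY 2≤8 k (Agree-weaken (+-monoʳ-≤ 2 (≤-trans k≤3 (m≤m+n 3 3))) AX) i+k<n))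
         (cong₂ _<ᵇ_ (cong (4 * k +_) (potential-agree AX′ AY 3≤5 3≤8)) potential≡)

  hasDecreasingMove-agree : hasDecreasingMove n m i j ≡ hasDecreasingMove n' m' i' j'
  hasDecreasingMove-agree =
    cong or (map-cong-local (All.map (λ {mv} → decreasingMove-agree (proj₁ mv) (proj₂ mv)) moves-short))

-- reducedCheck i d j e: in the grid with 1 + i + d rows and 1 + j + e columns
-- the square (i , j) has a decreasing move, unless the grid has fewer than 3
-- rows or columns, (i , j) is the origin, or the grid has 4 rows but more
-- than 4 columns (a shape excluded by m ≤ n).
reducedCheck : ℕ → ℕ → ℕ → ℕ → Bool
reducedCheck i d j e =
  ((i + d) <ᵇ 2) ∨ ((j + e) <ᵇ 2) ∨ ((i + j) ≡ᵇ 0) ∨ (((i + d) ≡ᵇ 3) ∧ (3 <ᵇ (j + e)))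
  ∨ hasDecreasingMove (suc (i + d)) (suc (j + e)) i j

allReducedChecks : T (allBelow 12 λ i → allBelow 12 λ d → allBelow 12 λ j → allBelow 12 (reducedCheck i d j))
allReducedChecks = tt

reducedCheck-holds : ∀ i d j e → i < 12 → d < 12 → j < 12 → e < 12 → reducedCheck i d j e ≡ true
reducedCheck-holds i d j e i<12 d<12 j<12 e<12 =
  allBelow²-sound 12 (reducedCheck i d)
    (≡true⇒T (allBelow²-sound 12 (λ i d → allBelow 12 λ j → allBelow 12 (reducedCheck i d j)) allReducedChecks i d i<12 d<12))
    j e j<12 e<12

reduce : ℕ → ℕ
reduce x = if x <ᵇ 8 then x else 8 + mod4 x

reduce-small : ∀ {x} → x < 8 → reduce x ≡ x
reduce-small x<8 rewrite <⇒<ᵇ′ x<8 = refl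

reduce-large : ∀ {x} → 8 ≤ x → reduce x ≡ 8 + mod4 x
reduce-large {x} 8≤x rewrite ≮⇒<ᵇ-false {x} {8} (≤⇒≯ 8≤x) = refl

reduce<12 : ∀ x → reduce x < 12
reduce<12 x with x <? 8
... | yes x<8 rewrite reduce-small x<8 = ≤-trans x<8 (m≤m+n 8 4)
... | no  x≮8 rewrite reduce-large (≮⇒≥ x≮8) = +-monoʳ-< 8 (mod4<4 x)

mod4-reduce : ∀ x → mod4 (reduce x) ≡ mod4 x
mod4-reduce x with x <? 8
... | yes x<8 rewrite reduce-small x<8 = refl
... | no  x≮8 rewrite reduce-large (≮⇒≥ x≮8) = mod4-idem x

reduce-large≥8 : ∀ {x} → 8 ≤ x → 8 ≤ reduce x
reduce-large≥8 {x} 8≤x = subst (8 ≤_) (sym (reduce-large 8≤x)) (m≤m+n 8 (mod4 x))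

reduce-fixes : ∀ x → reduce x < 8 → reduce x ≡ x
reduce-fixes x r<8 with x <? 8
... | yes x<8 = reduce-small x<8
... | no  x≮8 = ⊥-elim (<⇒≱ r<8 (reduce-large≥8 (≮⇒≥ x≮8)))

Agree-reduce : ∀ {n i} → i < n → Agree 8 n i (suc (reduce i + reduce (n ∸ suc i))) (reduce i)
Agree-reduce {n} {i} i<n = record
  { d = n ∸ suc i ; d' = reduce (n ∸ suc i)
  ; length≡ = sym (m+[n∸m]≡n i<n) ; length′≡ = refl
  ; near-start = λ p → sym (reduce-small p)
  ; far-start  = reduce-large≥8
  ; near-end   = λ p → sym (reduce-small p)
  ; far-end    = reduce-large≥8
  ; pos-mod4 = sym (mod4-reduce i)
  ; len-mod4 = trans (cong mod4 (sym (m+[n∸m]≡n i<n)))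
      (mod4-suc-cong (i + (n ∸ suc i)) (reduce i + reduce (n ∸ suc i))
        (trans (mod4-+ˡ i (reduce i) (n ∸ suc i) (sym (mod4-reduce i)))
               (mod4-+ʳ (reduce i) (n ∸ suc i) (reduce (n ∸ suc i)) (sym (mod4-reduce (n ∸ suc i)))))) }

line-length : ∀ {n i} → i < n → n ≡ suc (i + (n ∸ suc i))
line-length i<n = sym (m+[n∸m]≡n i<n)

reducedSpan : ℕ → ℕ → ℕ
reducedSpan n i = reduce i + reduce (n ∸ suc i)

reduce-thick : ∀ x y → 2 ≤ x + y → 2 ≤ reduce x + reduce y
reduce-thick x y 2≤x+y with x <? 8 | y <? 8
... | yes x<8 | yes y<8 rewrite reduce-small x<8 | reduce-small y<8 = 2≤x+y
... | no x≮8 | _ = ≤-trans (≤-trans (m≤m+n 2 6) (reduce-large≥8 (≮⇒≥ x≮8))) (m≤m+n (reduce x) (reduce y))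
... | yes _ | no y≮8 = ≤-trans (≤-trans (m≤m+n 2 6) (reduce-large≥8 (≮⇒≥ y≮8))) (m≤n+m (reduce y) (reduce x))

reducedSpan-thick : ∀ {n i} → i < n → 3 ≤ n → 2 ≤ reducedSpan n i
reducedSpan-thick {n} {i} i<n 3≤n = reduce-thick i (n ∸ suc i) (≤-pred (subst (3 ≤_) (line-length i<n) 3≤n))

reduce-zero : ∀ x → reduce x ≡ 0 → x ≡ 0
reduce-zero x r≡0 = trans (sym (reduce-fixes x (subst (_< 8) (sym r≡0) (s≤s z≤n)))) r≡0

reducedSpan-short⇒short : ∀ {n i} → i < n → reducedSpan n i ≤ 3 → n ≤ 4
reducedSpan-short⇒short {n} {i} i<n r≤3 =
  subst (_≤ 4) (sym (line-length i<n)) (s≤s (subst (_≤ 3) (cong₂ _+_ (fixed i (m≤m+n _ _)) (fixed (n ∸ suc i) (m≤n+m _ _))) r≤3))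
  where
  fixed : ∀ x → reduce x ≤ reducedSpan n i → reduce x ≡ x
  fixed x r≤ = reduce-fixes x (s≤s (≤-trans r≤ (≤-trans r≤3 (m≤m+n 3 4))))

short⇒reducedSpan-short : ∀ {n i} → i < n → n ≤ 4 → reducedSpan n i ≤ 3
short⇒reducedSpan-short {n} {i} i<n n≤4 =
  subst (_≤ 3) (sym (cong₂ _+_ (fixed i (m≤m+n _ _)) (fixed (n ∸ suc i) (m≤n+m _ _)))) span≤3
  where
  span≤3 : i + (n ∸ suc i) ≤ 3
  span≤3 = ≤-pred (subst (_≤ 4) (line-length i<n) n≤4)
  fixed : ∀ x → x ≤ i + (n ∸ suc i) → reduce x ≡ x
  fixed x x≤ = reduce-small (s≤s (≤-trans x≤ (≤-trans span≤3 (m≤m+n 3 4))))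

hasDecreasingMove-everywhere : ∀ {n m i j} → 3 ≤ m → m ≤ n → i < n → j < m → ¬ (i ≡ 0 × j ≡ 0) →
                               hasDecreasingMove n m i j ≡ true
hasDecreasingMove-everywhere {n} {m} {i} {j} 3≤m m≤n i<n j<m notOrigin =
  trans (hasDecreasingMove-agree (Agree-reduce i<n) (Agree-reduce j<m))
    (∨-false-left notFourRows (∨-false-left notAtOrigin (∨-false-left colsThick (∨-false-left rowsThick
      (reducedCheck-holds (reduce i) (reduce (n ∸ suc i)) (reduce j) (reduce (m ∸ suc j))
        (reduce<12 i) (reduce<12 (n ∸ suc i)) (reduce<12 j) (reduce<12 (m ∸ suc j)))))))
  where
  rowsThick : (reducedSpan n i <ᵇ 2) ≡ false
  rowsThick = ≮⇒<ᵇ-false (≤⇒≯ (reducedSpan-thick i<n (≤-trans 3≤m m≤n)))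
  colsThick : (reducedSpan m j <ᵇ 2) ≡ false
  colsThick = ≮⇒<ᵇ-false (≤⇒≯ (reducedSpan-thick j<m 3≤m))
  notAtOrigin : ((reduce i + reduce j) ≡ᵇ 0) ≡ false
  notAtOrigin = ¬true⇒false λ e → let sum≡0 = ≡ᵇ⇒≡′ e in
    notOrigin (reduce-zero i (m+n≡0⇒m≡0 (reduce i) sum≡0) , reduce-zero j (m+n≡0⇒n≡0 (reduce i) sum≡0))
  -- Four reduced rows means four rows, hence (m ≤ n) at most four columns.
  notFourRows : ((reducedSpan n i ≡ᵇ 3) ∧ (3 <ᵇ reducedSpan m j)) ≡ false
  notFourRows = ¬true⇒false λ e →
    let n≤4 = reducedSpan-short⇒short i<n (≤-reflexive (≡ᵇ⇒≡′ (∧-conicalˡ _ _ e)))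
    in <⇒≱ (<ᵇ⇒<′ (∧-conicalʳ (reducedSpan n i ≡ᵇ 3) _ e)) (short⇒reducedSpan-short j<m (≤-trans m≤n n≤4))

-- The rank changes along a slide of length k by 4k plus the change of potential.
rank-before : ∀ a b c d k → a + k ≡ b → c < 4 * k + d → 4 * a + c < 4 * b + d
rank-before a b c d k a+k≡b lt = subst (4 * a + c <_) eq (+-monoʳ-< (4 * a) lt)
  where
  eq : 4 * a + (4 * k + d) ≡ 4 * b + d
  eq = trans (sym (+-assoc (4 * a) (4 * k) d)) (cong (_+ d) (trans (sym (*-distribˡ-+ 4 a k)) (cong (4 *_) a+k≡b)))

rank-after : ∀ a b c d k → a + k ≡ b → 4 * k + c < d → 4 * b + c < 4 * a + d
rank-after a b c d k a+k≡b lt = subst (_< 4 * a + d) eq (+-monoʳ-< (4 * a) lt)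
  where
  eq : 4 * a + (4 * k + c) ≡ 4 * b + c
  eq = trans (sym (+-assoc (4 * a) (4 * k) c)) (cong (_+ c) (trans (sym (*-distribˡ-+ 4 a k)) (cong (4 *_) a+k≡b)))

+-swapʳ : ∀ a b c → a + b + c ≡ a + c + b
+-swapʳ = solve-∀

origin? : ∀ i j → (i ≡ 0 × j ≡ 0) ⊎ ¬ (i ≡ 0 × j ≡ 0)
origin? zero    zero    = inj₁ (refl , refl)
origin? zero    (suc j) = inj₂ λ ()
origin? (suc i) j       = inj₂ λ ()

module Reachability (n m : ℕ) where
  open WallSet n m
  open SlideSoundness n m

  rank : ℕ → ℕ → ℕ
  rank i j = 4 * (i + j) + potential n m i j

  ReachableBelow : ℕ → ℕ → Set
  ReachableBelow i j = ∀ {i' j'} → i' < n → j' < m → rank i' j' < rank i j → Reachable n m walls (i' , j')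

  rightMove-reaches : ∀ {i j} → i < n → j < m → ReachableBelow i j →
                      ∀ k → decreasingMove n m i j right k ≡ true → Reachable n m walls (i , j)
  rightMove-reaches {i} {j} i<n j<m below k e =
    subst (λ y → Reachable n m walls (i , y)) j∸k+k≡j (step right from slide)
    where
    k≤j : k ≤ j
    k≤j = ≤ᵇ⇒≤′ (∧-conicalˡ (k ≤ᵇ j) _ e)
    rest : (slidesRight n m i (j ∸ k) k ∧ (potential n m i (j ∸ k) <ᵇ 4 * k + potential n m i j)) ≡ true
    rest = ∧-conicalʳ (k ≤ᵇ j) _ e
    j∸k+k≡j : j ∸ k + k ≡ j
    j∸k+k≡j = m∸n+n≡m k≤j
    from : Reachable n m walls (i , j ∸ k)
    from = below i<n (≤-<-trans (m∸n≤m j k) j<m)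
      (rank-before (i + (j ∸ k)) (i + j) _ _ k (trans (+-assoc i (j ∸ k) k) (cong (i +_) j∸k+k≡j))
        (<ᵇ⇒<′ (∧-conicalʳ (slidesRight n m i (j ∸ k) k) _ rest)))
    slide : Slide n m walls right (i , j ∸ k) (i , j ∸ k + k)
    slide = slideRight-sound k i (j ∸ k) (∧-conicalˡ _ _ rest) (subst (_< m) (sym j∸k+k≡j) j<m)

  leftMove-reaches : ∀ {i j} → i < n → ReachableBelow i j →
                     ∀ k → decreasingMove n m i j left k ≡ true → Reachable n m walls (i , j)
  leftMove-reaches {i} {j} i<n below k e = step left from slide
    where
    j+k<m : j + k < m
    j+k<m = ≤ᵇ⇒≤′ (∧-conicalˡ (suc (j + k) ≤ᵇ m) _ e)
    rest : ((blockedLeft n m i j ∧ clearH n m i j k) ∧ (4 * k + potential n m i (j + k) <ᵇ potential n m i j)) ≡ true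
    rest = ∧-conicalʳ (suc (j + k) ≤ᵇ m) _ e
    from : Reachable n m walls (i , j + k)
    from = below i<n j+k<m
      (rank-after (i + j) (i + (j + k)) _ _ k (+-assoc i j k)
        (<ᵇ⇒<′ (∧-conicalʳ (blockedLeft n m i j ∧ clearH n m i j k) _ rest)))
    slide : Slide n m walls left (i , j + k) (i , j)
    slide = slideLeft-sound k i j (∧-conicalˡ _ _ rest)

  downMove-reaches : ∀ {i j} → i < n → j < m → ReachableBelow i j →
                     ∀ k → decreasingMove n m i j down k ≡ true → Reachable n m walls (i , j)
  downMove-reaches {i} {j} i<n j<m below k e =
    subst (λ x → Reachable n m walls (x , j)) i∸k+k≡i (step down from slide)
    where
    k≤i : k ≤ i
    k≤i = ≤ᵇ⇒≤′ (∧-conicalˡ (k ≤ᵇ i) _ e)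
    rest : (slidesDown n m (i ∸ k) j k ∧ (potential n m (i ∸ k) j <ᵇ 4 * k + potential n m i j)) ≡ true
    rest = ∧-conicalʳ (k ≤ᵇ i) _ e
    i∸k+k≡i : i ∸ k + k ≡ i
    i∸k+k≡i = m∸n+n≡m k≤i
    from : Reachable n m walls (i ∸ k , j)
    from = below (≤-<-trans (m∸n≤m i k) i<n) j<m
      (rank-before ((i ∸ k) + j) (i + j) _ _ k (trans (+-swapʳ (i ∸ k) j k) (cong (_+ j) i∸k+k≡i))
        (<ᵇ⇒<′ (∧-conicalʳ (slidesDown n m (i ∸ k) j k) _ rest)))
    slide : Slide n m walls down (i ∸ k , j) (i ∸ k + k , j)
    slide = slideDown-sound k (i ∸ k) j (∧-conicalˡ _ _ rest) (subst (_< n) (sym i∸k+k≡i) i<n)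

  upMove-reaches : ∀ {i j} → j < m → ReachableBelow i j →
                   ∀ k → decreasingMove n m i j up k ≡ true → Reachable n m walls (i , j)
  upMove-reaches {i} {j} j<m below k e = step up from slide
    where
    i+k<n : i + k < n
    i+k<n = ≤ᵇ⇒≤′ (∧-conicalˡ (suc (i + k) ≤ᵇ n) _ e)
    rest : ((blockedUp n m i j ∧ clearV n m i j k) ∧ (4 * k + potential n m (i + k) j <ᵇ potential n m i j)) ≡ true
    rest = ∧-conicalʳ (suc (i + k) ≤ᵇ n) _ e
    from : Reachable n m walls (i + k , j)
    from = below i+k<n j<m
      (rank-after (i + j) (i + k + j) _ _ k (+-swapʳ i j k)
        (<ᵇ⇒<′ (∧-conicalʳ (blockedUp n m i j ∧ clearV n m i j k) _ rest)))
    slide : Slide n m walls up (i + k , j) (i , j)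
    slide = slideUp-sound k i j (∧-conicalˡ _ _ rest)

  decreasingMove-reaches : ∀ {i j} → i < n → j < m → ReachableBelow i j →
                           ∀ dir k → decreasingMove n m i j dir k ≡ true → Reachable n m walls (i , j)
  decreasingMove-reaches i<n j<m below right = rightMove-reaches i<n j<m below
  decreasingMove-reaches i<n j<m below left  = leftMove-reaches i<n below
  decreasingMove-reaches i<n j<m below down  = downMove-reaches i<n j<m below
  decreasingMove-reaches i<n j<m below up    = upMove-reaches j<m below

  allReachable : 3 ≤ m → m ≤ n → ∀ {i j} → i < n → j < m → Reachable n m walls (i , j)
  allReachable 3≤m m≤n {i} {j} = <-rec P reach (rank i j) refl
    where
    P : ℕ → Set
    P r = ∀ {i j} → rank i j ≡ r → i < n → j < m → Reachable n m walls (i , j)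
    reach : ∀ r → (∀ {r'} → r' < r → P r') → P r
    reach r below {i} {j} refl i<n j<m with origin? i j
    ... | inj₁ (refl , refl) = start
    ... | inj₂ notOrigin
      with satisfied (any⁻ _ moves (≡true⇒T (hasDecreasingMove-everywhere 3≤m m≤n i<n j<m notOrigin)))
    ...   | (dir , k) , ok =
      decreasingMove-reaches i<n j<m (λ i'<n j'<m lt → below lt refl i'<n j'<m) dir k (T⇒≡true ok)

count : (ℕ → Bool) → ℕ → ℕ
count p zero    = 0
count p (suc L) = (if p L then 1 else 0) + count p L

length-select : ∀ p L → length (select p L) ≡ count p L
length-select p zero = refl
length-select p (suc L) with p L
... | true  = cong suc (length-select p L)
... | false = length-select p L

count-ext : ∀ {p q} L → (∀ j → p j ≡ q j) → count p L ≡ count q L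
count-ext zero    _   = refl
count-ext {p} {q} (suc L) p≗q = cong₂ (λ b c → (if b then 1 else 0) + c) (p≗q L) (count-ext L p≗q)

count-mono : ∀ {p q} L → (∀ j → p j ≡ true → q j ≡ true) → count p L ≤ count q L
count-mono zero _ = z≤n
count-mono {p} {q} (suc L) p⇒q with p L in pL | q L in qL
... | true  | true  = s≤s (count-mono L p⇒q)
... | true  | false with () ← trans (sym (p⇒q L pL)) qL
... | false | true  = ≤-trans (count-mono L p⇒q) (n≤1+n _)
... | false | false = count-mono L p⇒q

count-∨ : ∀ p q L → count (λ j → p j ∨ q j) L ≤ count p L + count q L
count-∨ p q zero = z≤n
count-∨ p q (suc L) with p L | q L
... | true  | true  = s≤s (≤-trans (count-∨ p q L) (+-monoʳ-≤ (count p L) (n≤1+n _)))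
... | true  | false = s≤s (count-∨ p q L)
... | false | true  = subst (suc (count (λ j → p j ∨ q j) L) ≤_) (sym (+-suc (count p L) (count q L))) (s≤s (count-∨ p q L))
... | false | false = count-∨ p q L

count-≡1 : ∀ L → count (_≡ᵇ 1) L ≤ 1
count-≡1 zero                = z≤n
count-≡1 (suc zero)          = z≤n
count-≡1 (suc (suc zero))    = s≤s z≤n
count-≡1 (suc (suc (suc L))) = count-≡1 (suc (suc L))

indicator : ℕ → ℕ → ℕ
indicator r a = if r ≡ᵇ a then 1 else 0

residueCount : ℕ → ℕ → ℕ
residueCount a L = count (λ j → mod4 j ≡ᵇ a) L

rotationHitsOnce : T (allBelow 4 λ r → allBelow 4 λ a →
  indicator (next4 (next4 (next4 r))) a + (indicator (next4 (next4 r)) a + (indicator (next4 r) a + indicator r a)) ≡ᵇ 1)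
rotationHitsOnce = tt

rotationSum-at : ∀ a L → a < 4 →
  indicator (mod4 (3 + L)) a + (indicator (mod4 (2 + L)) a + (indicator (mod4 (1 + L)) a + indicator (mod4 L) a)) ≡ 1
rotationSum-at a L a<4 rewrite mod4-3+ L | mod4-2+ L | mod4-suc L =
  ≡ᵇ⇒≡′ (allBelow²-sound 4 (λ r a → indicator (next4 (next4 (next4 r))) a + (indicator (next4 (next4 r)) a
          + (indicator (next4 r) a + indicator r a)) ≡ᵇ 1) rotationHitsOnce (mod4 L) a (mod4<4 L) a<4)

residueCount-+4 : ∀ a L → a < 4 → residueCount a (4 + L) ≡ suc (residueCount a L)
residueCount-+4 a L a<4 = begin
  residueCount a (4 + L)
    ≡⟨⟩
  indicator (mod4 (3 + L)) a + (indicator (mod4 (2 + L)) a + (indicator (mod4 (1 + L)) a + (indicator (mod4 L) a + residueCount a L)))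
    ≡⟨ regroup (indicator (mod4 (3 + L)) a) (indicator (mod4 (2 + L)) a) (indicator (mod4 (1 + L)) a) (indicator (mod4 L) a) (residueCount a L) ⟩
  indicator (mod4 (3 + L)) a + (indicator (mod4 (2 + L)) a + (indicator (mod4 (1 + L)) a + indicator (mod4 L) a)) + residueCount a L
    ≡⟨ cong (_+ residueCount a L) (rotationSum-at a L a<4) ⟩
  suc (residueCount a L) ∎
  where
  open ≡-Reasoning
  regroup : ∀ w x y z c → w + (x + (y + (z + c))) ≡ w + (x + (y + z)) + c
  regroup = solve-∀

residueCounts-total : ∀ L → residueCount 0 L + (residueCount 1 L + (residueCount 2 L + residueCount 3 L)) ≡ L
residueCounts-total zero    = refl
residueCounts-total (suc L) =
  trans (regroup (indicator r 0) (indicator r 1) (indicator r 2) (indicator r 3)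
                 (residueCount 0 L) (residueCount 1 L) (residueCount 2 L) (residueCount 3 L))
        (cong₂ _+_ (one r (mod4<4 L)) (residueCounts-total L))
  where
  r = mod4 L
  regroup : ∀ a b c d w x y z → (a + w) + ((b + x) + ((c + y) + (d + z))) ≡ (a + (b + (c + d))) + (w + (x + (y + z)))
  regroup = solve-∀
  one : ∀ r → r < 4 → indicator r 0 + (indicator r 1 + (indicator r 2 + indicator r 3)) ≡ 1
  one 0 _ = refl
  one 1 _ = refl
  one 2 _ = refl
  one 3 _ = refl
  one (suc (suc (suc (suc _)))) (s≤s (s≤s (s≤s (s≤s ()))))

smallResidueCounts : T (allBelow 4 λ a → allBelow 4 λ L → 4 * residueCount a L + a ≤ᵇ L + 3)
smallResidueCounts = tt

residueCount-bound-small : ∀ a L → a < 4 → L < 4 → 4 * residueCount a L + a ≤ L + 3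
residueCount-bound-small a L a<4 L<4 =
  ≤ᵇ⇒≤′ (allBelow²-sound 4 (λ a L → 4 * residueCount a L + a ≤ᵇ L + 3) smallResidueCounts a L a<4 L<4)

residueCount-bound : ∀ a L → a < 4 → 4 * residueCount a L + a ≤ L + 3
residueCount-bound a 0 a<4 = residueCount-bound-small a 0 a<4 (s≤s z≤n)
residueCount-bound a 1 a<4 = residueCount-bound-small a 1 a<4 (s≤s (s≤s z≤n))
residueCount-bound a 2 a<4 = residueCount-bound-small a 2 a<4 (s≤s (s≤s (s≤s z≤n)))
residueCount-bound a 3 a<4 = residueCount-bound-small a 3 a<4 ≤-refl
residueCount-bound a (suc (suc (suc (suc L)))) a<4 = begin
  4 * residueCount a (4 + L) + a  ≡⟨ cong (λ c → 4 * c + a) (residueCount-+4 a L a<4) ⟩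
  4 * suc (residueCount a L) + a  ≡⟨ shift (residueCount a L) ⟩
  4 + (4 * residueCount a L + a)  ≤⟨ +-monoʳ-≤ 4 (residueCount-bound a L a<4) ⟩
  4 + (L + 3)                     ∎
  where
  open ≤-Reasoning
  shift : ∀ c → 4 * suc c + a ≡ 4 + (4 * c + a)
  shift c = trans (cong (_+ a) (*-suc 4 c)) (+-assoc 4 (4 * c) a)

-- cyclicSum c L k: the walls below L of k consecutive lines whose patterns
-- select the consecutive residues c + 1, c + 2, …, c + k.
cyclicSum : ℕ → ℕ → ℕ → ℕ
cyclicSum c L zero    = 0
cyclicSum c L (suc k) = cyclicSum c L k + residueCount (mod4 (suc (k + c))) L

residueSum : ℕ → ℕ → ℕ
residueSum c zero    = 0
residueSum c (suc k) = residueSum c k + mod4 (suc (k + c))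

cyclicSum-weighted : ∀ c L k → 4 * cyclicSum c L k + residueSum c k ≤ k * (L + 3)
cyclicSum-weighted c L zero    = z≤n
cyclicSum-weighted c L (suc k) = begin
  4 * (S + C) + (R + r)      ≡⟨ regroup S C R r ⟩
  (4 * S + R) + (4 * C + r)  ≤⟨ +-mono-≤ (cyclicSum-weighted c L k) (residueCount-bound r L (mod4<4 (suc (k + c)))) ⟩
  k * (L + 3) + (L + 3)      ≡⟨ +-comm (k * (L + 3)) (L + 3) ⟩
  suc k * (L + 3)            ∎
  where
  open ≤-Reasoning
  r = mod4 (suc (k + c))
  S = cyclicSum c L k
  C = residueCount r L
  R = residueSum c k
  regroup : ∀ S C R r → 4 * (S + C) + (R + r) ≡ (4 * S + R) + (4 * C + r)
  regroup = solve-∀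

four-consecutive : ∀ L x →
  residueCount (mod4 (suc x)) L + residueCount (mod4 (2 + x)) L + residueCount (mod4 (3 + x)) L + residueCount (mod4 x) L ≡ L
four-consecutive L x rewrite mod4-3+ x | mod4-2+ x | mod4-suc x = rotated (mod4 x) (mod4<4 x)
  where
  C : ℕ → ℕ
  C a = residueCount a L
  total : C 0 + C 1 + C 2 + C 3 ≡ L
  total = trans (+-assoc3 (C 0) (C 1) (C 2) (C 3)) (residueCounts-total L)
    where
    +-assoc3 : ∀ a b c d → a + b + c + d ≡ a + (b + (c + d))
    +-assoc3 = solve-∀
  rotate : ∀ a b c d → a + b + c + d ≡ b + c + d + a
  rotate = solve-∀
  rotated : ∀ r → r < 4 → C (next4 r) + C (next4 (next4 r)) + C (next4 (next4 (next4 r))) + C r ≡ L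
  rotated 0 _ = trans (rotate (C 1) (C 2) (C 3) (C 0)) (trans (rotate (C 2) (C 3) (C 0) (C 1)) (trans (rotate (C 3) (C 0) (C 1) (C 2)) total))
  rotated 1 _ = trans (rotate (C 2) (C 3) (C 0) (C 1)) (trans (rotate (C 3) (C 0) (C 1) (C 2)) total)
  rotated 2 _ = trans (rotate (C 3) (C 0) (C 1) (C 2)) total
  rotated 3 _ = total
  rotated (suc (suc (suc (suc _)))) (s≤s (s≤s (s≤s (s≤s ()))))

cyclicSum-+4 : ∀ c L k → cyclicSum c L (4 + k) ≡ cyclicSum c L k + L
cyclicSum-+4 c L k = trans (regroup (cyclicSum c L k) _ _ _ _) (cong (cyclicSum c L k +_) (four-consecutive L (k + c)))
  where
  regroup : ∀ S a b c d → S + a + b + c + d ≡ S + (a + b + c + d)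
  regroup = solve-∀

cyclicSum-short : ∀ c L e k → 3 * k ≤ residueSum c k + e → 4 * cyclicSum c L k ≤ k * L + e
cyclicSum-short c L e k 3k≤R+e = +-cancelʳ-≤ R (4 * cyclicSum c L k) (k * L + e) (begin
  4 * cyclicSum c L k + R  ≤⟨ cyclicSum-weighted c L k ⟩
  k * (L + 3)              ≡⟨ expand k L ⟩
  k * L + 3 * k            ≤⟨ +-monoʳ-≤ (k * L) 3k≤R+e ⟩
  k * L + (R + e)          ≡⟨ regroup (k * L) R e ⟩
  k * L + e + R            ∎)
  where
  open ≤-Reasoning
  R = residueSum c k
  expand : ∀ k L → k * (L + 3) ≡ k * L + 3 * k
  expand = solve-∀
  regroup : ∀ x R e → x + (R + e) ≡ x + e + R
  regroup = solve-∀

cyclicSum-bound : ∀ c L e → (∀ k → k < 4 → 3 * k ≤ residueSum c k + e) → ∀ k → 4 * cyclicSum c L k ≤ k * L + e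
cyclicSum-bound c L e short (suc (suc (suc (suc k)))) = begin
  4 * cyclicSum c L (4 + k)       ≡⟨ cong (4 *_) (cyclicSum-+4 c L k) ⟩
  4 * (cyclicSum c L k + L)       ≡⟨ *-distribˡ-+ 4 (cyclicSum c L k) L ⟩
  4 * cyclicSum c L k + 4 * L     ≤⟨ +-monoˡ-≤ (4 * L) (cyclicSum-bound c L e short k) ⟩
  k * L + e + 4 * L               ≡⟨ regroup k L e ⟩
  (4 + k) * L + e                 ∎
  where
  open ≤-Reasoning
  regroup : ∀ k L e → k * L + e + 4 * L ≡ (4 + k) * L + e
  regroup = solve-∀
cyclicSum-bound c L e short 0 = cyclicSum-short c L e 0 (short 0 (s≤s z≤n))
cyclicSum-bound c L e short 1 = cyclicSum-short c L e 1 (short 1 (s≤s (s≤s z≤n)))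
cyclicSum-bound c L e short 2 = cyclicSum-short c L e 2 (short 2 (s≤s (s≤s (s≤s z≤n))))
cyclicSum-bound c L e short 3 = cyclicSum-short c L e 3 (short 3 ≤-refl)

-- The interior rows cycle through the residues 1, 2, 3, 0, …, the interior
-- columns through 2, 3, 0, 1, ….
interiorRows-short : T (allBelow 4 λ k → 3 * k ≤ᵇ residueSum 0 k + 3)
interiorRows-short = tt

interiorCols-short : T (allBelow 4 λ k → 3 * k ≤ᵇ residueSum 1 k + 4)
interiorCols-short = tt

interiorRows-bound : ∀ L k → 4 * cyclicSum 0 L k ≤ k * L + 3
interiorRows-bound L = cyclicSum-bound 0 L 3 λ k k<4 → ≤ᵇ⇒≤′ (allBelow-sound 4 (λ k → 3 * k ≤ᵇ residueSum 0 k + 3) interiorRows-short k k<4)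

interiorCols-bound : ∀ L k → 4 * cyclicSum 1 L k ≤ k * L + 4
interiorCols-bound L = cyclicSum-bound 1 L 4 λ k k<4 → ≤ᵇ⇒≤′ (allBelow-sound 4 (λ k → 3 * k ≤ᵇ residueSum 1 k + 4) interiorCols-short k k<4)

positive⇒suc : ∀ {x} → 0 < x → Σ ℕ λ z → x ≡ suc z
positive⇒suc {suc x} _ = x , refl

≡⇒≡ᵇ′ : ∀ {a b} → a ≡ b → (a ≡ᵇ b) ≡ true
≡⇒≡ᵇ′ {a} {b} = T⇒≡true ∘ ≡⇒≡ᵇ a b

≡ᵇ-cong-⇔ : ∀ a b c d → (a ≡ b → c ≡ d) → (c ≡ d → a ≡ b) → (a ≡ᵇ b) ≡ (c ≡ᵇ d)
≡ᵇ-cong-⇔ a b c d to from with a ≡ᵇ b in ab | c ≡ᵇ d in cd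
... | true  | true  = refl
... | false | false = refl
... | true  | false with () ← trans (sym (≡⇒≡ᵇ′ (to (≡ᵇ⇒≡′ ab)))) cd
... | false | true  with () ← trans (sym (≡⇒≡ᵇ′ (from (≡ᵇ⇒≡′ cd)))) ab

residue-shift : ∀ x j → (mod4 j ≡ᵇ mod4 (3 + x)) ≡ (mod4 x ≡ᵇ mod4 (suc j))
residue-shift x j = ≡ᵇ-cong-⇔ (mod4 j) (mod4 (3 + x)) (mod4 x) (mod4 (suc j))
  (λ e → sym (mod4-suc-cong j (3 + x) e))
  (λ e → sym (mod4-suc-cancel (3 + x) j e))

firstColumn : ℕ → Bool
firstColumn i = (i ≡ᵇ 1) ∨ ((mod4 i ≡ᵇ 0) ∧ not (i ≡ᵇ 0))

firstColumn-bound : ∀ L → 4 * count firstColumn L ≤ L + 7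
firstColumn-bound L = begin
  4 * count firstColumn L                       ≤⟨ *-monoʳ-≤ 4 (count-∨ (_≡ᵇ 1) rest L) ⟩
  4 * (count (_≡ᵇ 1) L + count rest L)          ≤⟨ *-monoʳ-≤ 4 (+-mono-≤ (count-≡1 L) (count-mono L (λ j → ∧-conicalˡ (mod4 j ≡ᵇ 0) _))) ⟩
  4 * (1 + residueCount 0 L)                    ≡⟨ regroup (residueCount 0 L) ⟩
  4 + (4 * residueCount 0 L + 0)                ≤⟨ +-monoʳ-≤ 4 (residueCount-bound 0 L (s≤s z≤n)) ⟩
  4 + (L + 3)                                   ≡⟨ +-comm 4 (L + 3) ⟩
  L + 3 + 4                                     ≡⟨ +-assoc L 3 4 ⟩
  L + 7                                         ∎
  where
  open ≤-Reasoning
  rest : ℕ → Bool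
  rest i = (mod4 i ≡ᵇ 0) ∧ not (i ≡ᵇ 0)
  regroup : ∀ c → 4 * (1 + c) ≡ 4 + (4 * c + 0)
  regroup = solve-∀

module WallCount (a b : ℕ) where
  open WallSet (2 + a) (2 + b)

  interiorRow-length : ∀ K → 2 + K < 2 + a → length (hRow (suc K)) ≡ residueCount (mod4 (suc K)) (suc b)
  interiorRow-length K lt =
    trans (length-map (H (suc K)) (select (hPattern (2 + a) (2 + b) (suc K)) (suc b)))
      (trans (length-select _ (suc b)) (count-ext (suc b) rowPattern))
    where
    rowPattern : ∀ j → hPattern (2 + a) (2 + b) (suc K) j ≡ (mod4 j ≡ᵇ mod4 (suc K))
    rowPattern j with positive⇒suc (m<n⇒0<n∸m lt)
    ... | _ , notLast rewrite notLast = refl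

  hWalls-length : ∀ K → suc K < 2 + a → length (hWalls (suc K)) ≡ cyclicSum 0 (suc b) K + residueCount 3 (suc b)
  hWalls-length zero _ =
    trans (length-++ (hRow 0)) (trans (+-identityʳ _)
      (trans (length-map (H 0) (select (hPattern (2 + a) (2 + b) 0) (suc b))) (length-select _ (suc b))))
  hWalls-length (suc K) lt = begin
    length (hRow (suc K) ++ hWalls (suc K))
      ≡⟨ length-++ (hRow (suc K)) ⟩
    length (hRow (suc K)) + length (hWalls (suc K))
      ≡⟨ cong₂ _+_ (interiorRow-length K lt) (hWalls-length K (<-trans (n<1+n (suc K)) lt)) ⟩
    residueCount (mod4 (suc K)) (suc b) + (cyclicSum 0 (suc b) K + residueCount 3 (suc b))
      ≡⟨ regroup (residueCount (mod4 (suc K)) (suc b)) (cyclicSum 0 (suc b) K) (residueCount 3 (suc b)) ⟩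
    cyclicSum 0 (suc b) K + residueCount (mod4 (suc K)) (suc b) + residueCount 3 (suc b)
      ≡⟨ cong (λ z → cyclicSum 0 (suc b) K + residueCount (mod4 (suc z)) (suc b) + residueCount 3 (suc b)) (sym (+-identityʳ K)) ⟩
    cyclicSum 0 (suc b) (suc K) + residueCount 3 (suc b) ∎
    where
    open ≡-Reasoning
    regroup : ∀ x S y → x + (S + y) ≡ S + x + y
    regroup = solve-∀

  lastRow-bound : 4 * length (hRow (suc a)) ≤ suc b + 3
  lastRow-bound
    rewrite length-map (H (suc a)) (select (hPattern (2 + a) (2 + b) (suc a)) (suc b))
          | length-select (hPattern (2 + a) (2 + b) (suc a)) (suc b) | n∸n≡0 a
    with (2 + b ≡ᵇ 4) ∧ (mod4 (2 + a) ≡ᵇ 2)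
  ... | true  = ≤-trans (*-monoʳ-≤ 4 (count-≡1 (suc b))) (s≤s (m≤n+m 3 b))
  ... | false = ≤-trans (m≤m+n _ (mod4 (2 + a))) (residueCount-bound (mod4 (2 + a)) (suc b) (mod4<4 (2 + a)))

  hWalls-bound : 4 * length (hWalls (2 + a)) ≤ (2 + a) * suc b + 6
  hWalls-bound = +-cancelʳ-≤ 3 _ _ (begin
    4 * length (hWalls (2 + a)) + 3
      ≡⟨ cong (λ l → 4 * l + 3) (trans (length-++ (hRow (suc a))) (cong (length (hRow (suc a)) +_) (hWalls-length a ≤-refl))) ⟩
    4 * (length (hRow (suc a)) + (cyclicSum 0 (suc b) a + residueCount 3 (suc b))) + 3
      ≡⟨ expand (length (hRow (suc a))) (cyclicSum 0 (suc b) a) (residueCount 3 (suc b)) ⟩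
    4 * length (hRow (suc a)) + (4 * cyclicSum 0 (suc b) a + (4 * residueCount 3 (suc b) + 3))
      ≤⟨ +-mono-≤ lastRow-bound (+-mono-≤ (interiorRows-bound (suc b) a) (residueCount-bound 3 (suc b) ≤-refl)) ⟩
    suc b + 3 + (a * suc b + 3 + (suc b + 3))
      ≡⟨ collect a (suc b) ⟩
    (2 + a) * suc b + 6 + 3 ∎)
    where
    open ≤-Reasoning
    expand : ∀ x y z → 4 * (x + (y + z)) + 3 ≡ 4 * x + (4 * y + (4 * z + 3))
    expand = solve-∀
    collect : ∀ a L → L + 3 + (a * L + 3 + (L + 3)) ≡ (2 + a) * L + 6 + 3
    collect = solve-∀

  interiorCol-length : ∀ K → 2 + K < 2 + b → length (vCol (suc K)) ≡ residueCount (mod4 (2 + K)) (suc a)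
  interiorCol-length K lt =
    trans (length-map (λ x → V x (suc K)) (select (λ x → vPattern (2 + a) (2 + b) x (suc K)) (suc a)))
      (trans (length-select _ (suc a)) (count-ext (suc a) colPattern))
    where
    colPattern : ∀ x → vPattern (2 + a) (2 + b) x (suc K) ≡ (mod4 x ≡ᵇ mod4 (2 + K))
    colPattern x with positive⇒suc (m<n⇒0<n∸m lt)
    ... | _ , notLast rewrite notLast = residue-shift x (suc K)

  vWalls-length : ∀ K → suc K < 2 + b → length (vWalls (suc K)) ≡ cyclicSum 1 (suc a) K + count firstColumn (suc a)
  vWalls-length zero _ =
    trans (length-++ (vCol 0)) (trans (+-identityʳ _)
      (trans (length-map (λ x → V x 0) (select (λ x → vPattern (2 + a) (2 + b) x 0) (suc a))) (length-select _ (suc a))))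
  vWalls-length (suc K) lt = begin
    length (vCol (suc K) ++ vWalls (suc K))
      ≡⟨ length-++ (vCol (suc K)) ⟩
    length (vCol (suc K)) + length (vWalls (suc K))
      ≡⟨ cong₂ _+_ (interiorCol-length K lt) (vWalls-length K (<-trans (n<1+n (suc K)) lt)) ⟩
    residueCount (mod4 (2 + K)) (suc a) + (cyclicSum 1 (suc a) K + count firstColumn (suc a))
      ≡⟨ regroup (residueCount (mod4 (2 + K)) (suc a)) (cyclicSum 1 (suc a) K) (count firstColumn (suc a)) ⟩
    cyclicSum 1 (suc a) K + residueCount (mod4 (2 + K)) (suc a) + count firstColumn (suc a)
      ≡⟨ cong (λ z → cyclicSum 1 (suc a) K + residueCount (mod4 (suc z)) (suc a) + count firstColumn (suc a)) (+-comm 1 K) ⟩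
    cyclicSum 1 (suc a) (suc K) + count firstColumn (suc a) ∎
    where
    open ≡-Reasoning
    regroup : ∀ x S y → x + (S + y) ≡ S + x + y
    regroup = solve-∀

  lastCol-bound : 4 * length (vCol (suc b)) ≤ suc a + 3
  lastCol-bound
    rewrite length-map (λ x → V x (suc b)) (select (λ x → vPattern (2 + a) (2 + b) x (suc b)) (suc a))
          | length-select (λ x → vPattern (2 + a) (2 + b) x (suc b)) (suc a) | n∸n≡0 b =
    ≤-trans (m≤m+n _ (mod4 (3 + b))) (residueCount-bound (mod4 (3 + b)) (suc a) (mod4<4 (3 + b)))

  vWalls-bound : 4 * length (vWalls (2 + b)) ≤ (2 + b) * suc a + 14
  vWalls-bound = begin
    4 * length (vWalls (2 + b))
      ≡⟨ cong (4 *_) (trans (length-++ (vCol (suc b))) (cong (length (vCol (suc b)) +_) (vWalls-length b ≤-refl))) ⟩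
    4 * (length (vCol (suc b)) + (cyclicSum 1 (suc a) b + count firstColumn (suc a)))
      ≡⟨ expand (length (vCol (suc b))) (cyclicSum 1 (suc a) b) (count firstColumn (suc a)) ⟩
    4 * length (vCol (suc b)) + (4 * cyclicSum 1 (suc a) b + 4 * count firstColumn (suc a))
      ≤⟨ +-mono-≤ lastCol-bound (+-mono-≤ (interiorCols-bound (suc a) b) (firstColumn-bound (suc a))) ⟩
    suc a + 3 + (b * suc a + 4 + (suc a + 7))
      ≡⟨ collect b (suc a) ⟩
    (2 + b) * suc a + 14 ∎
    where
    open ≤-Reasoning
    expand : ∀ x y z → 4 * (x + (y + z)) ≡ 4 * x + (4 * y + 4 * z)
    expand = solve-∀
    collect : ∀ b L → L + 3 + (b * L + 4 + (L + 7)) ≡ (2 + b) * L + 14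
    collect = solve-∀

  x≤2⌈x/2⌉ : ∀ x → x ≤ 2 * ⌈ x /2⌉
  x≤2⌈x/2⌉ x = begin
    x                       ≡⟨ sym (⌊n/2⌋+⌈n/2⌉≡n x) ⟩
    ⌊ x /2⌋ + ⌈ x /2⌉       ≤⟨ +-monoˡ-≤ ⌈ x /2⌉ (⌊n/2⌋≤⌈n/2⌉ x) ⟩
    ⌈ x /2⌉ + ⌈ x /2⌉       ≡⟨ cong (⌈ x /2⌉ +_) (sym (+-identityʳ ⌈ x /2⌉)) ⟩
    2 * ⌈ x /2⌉             ∎
    where open ≤-Reasoning

  walls-bound : 4 * length walls ≤ 4 * ⌈ a * b /2⌉ + 3 * ((2 + b) + (2 + a)) + 12
  walls-bound = begin
    4 * length walls
      ≡⟨ trans (cong (4 *_) (length-++ (hWalls (2 + a)))) (*-distribˡ-+ 4 (length (hWalls (2 + a))) (length (vWalls (2 + b)))) ⟩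
    4 * length (hWalls (2 + a)) + 4 * length (vWalls (2 + b))
      ≤⟨ +-mono-≤ hWalls-bound vWalls-bound ⟩
    (2 + a) * suc b + 6 + ((2 + b) * suc a + 14)
      ≡⟨ collect a b ⟩
    2 * (a * b) + (3 * ((2 + b) + (2 + a)) + 12)
      ≤⟨ +-monoˡ-≤ _ (*-monoʳ-≤ 2 (x≤2⌈x/2⌉ (a * b))) ⟩
    2 * (2 * ⌈ a * b /2⌉) + (3 * ((2 + b) + (2 + a)) + 12)
      ≡⟨ regroup ⌈ a * b /2⌉ (3 * ((2 + b) + (2 + a))) ⟩
    4 * ⌈ a * b /2⌉ + 3 * ((2 + b) + (2 + a)) + 12 ∎
    where
    open ≤-Reasoning
    collect : ∀ a b → (2 + a) * suc b + 6 + ((2 + b) * suc a + 14) ≡ 2 * (a * b) + (3 * ((2 + b) + (2 + a)) + 12)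
    collect = solve-∀
    regroup : ∀ c s → 2 * (2 * c) + (s + 12) ≡ 4 * c + s + 12
    regroup = solve-∀

mainTheorem14 : ∀ (n m : ℕ) → 3 ≤ m → m ≤ n → OptBound n m
mainTheorem14 (suc (suc a)) (suc (suc b)) 3≤m m≤n =
  walls , (walls-unique , walls-valid , λ i j i<n j<m → allReachable 3≤m m≤n i<n j<m) , walls-bound
  where
  open WallSet (2 + a) (2 + b)
  open Reachability (2 + a) (2 + b)
  open WallCount a b
mainTheorem14 _ 0 () _
mainTheorem14 _ 1 (s≤s ()) _
mainTheorem14 _ 2 (s≤s (s≤s ())) _
mainTheorem14 0 (suc (suc (suc _))) _ ()
mainTheorem14 1 (suc (suc (suc _))) _ (s≤s ())
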